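{- Let $n\ge2$, and write $B_n(i,j)=M_n^{2,2}(i,j)$ and $b_n(i,j)=m_n^{2,2}(i,j)=\#B_n(i,j)$ for integers $i,j\ge0$. Then: (1) $B_n(i,j)=\left(12\sqcup\!\sqcup_O^+B_{n-2}(i,j)\right)\uplus\left(12\sqcup\!\sqcup_E^+B_{n-2}(i+1,j)\right)\uplus\left(21\sqcup\!\sqcup_E^+B_{n-2}(i,j+1)\right)\uplus\left(21\sqcup\!\sqcup_O^+B_{n-2}(i+1,j+1)\right)$. (2) $b_{2n}(i,j)=2n^2\,b_{2n-2}(i,j)+2n(n-1)\,b_{2n-2}(i+1,j)$ and $b_{2n+1}(i,j)=2n(n+1)\,b_{2n-1}(i,j)+2n^2\,b_{2n-1}(i+1,j)$. (3) The numbers $c_{2n}(i,j):=b_{2n}(i,j)/(2^{n-1}n!)$ and $c_{2n+1}(i,j):=b_{2n+1}(i,j)/(2^{n-1}n!)$ are integers and satisfy $c_{2n}(i,j)=n\,c_{2n-2}(i,j)+(n-1)\,c_{2n-2}(i+1,j)$ and $c_{2n+1}(i,j)=(n+1)\,c_{2n-1}(i,j)+n\,c_{2n-1}(i+1,j)$. (4) $b_n(i,j)=b_n(i+1,j+1)$. (5) $b_{2n}(i,j)=2n\,b_{2n-1}(i,j)$ for all $i,j$.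
   Context: $S_N$ is the symmetric group on $[N]$ ($S_0$ consists of the empty permutation). For $\pi=a_1\cdots a_N\in S_N$: $\mathrm{inv}\,\pi=\#\{(r,s):r<s,\ a_r>a_s\}$; $\mathrm{maj}\,\pi=\sum_{a_i>a_{i+1}}i$; $\mathrm{imaj}\,\pi=\mathrm{maj}\,\pi^{ -1}=\sum i$ over those $i$ such that $i+1$ appears to the left of $i$ in $\pi$. $M_N^{k,l}(i,j)=\{\pi\in S_N:\ \mathrm{inv}\,\pi\equiv i\pmod k,\ \mathrm{imaj}\,\pi\equiv j\pmod l\}$ and $m_N^{k,l}(i,j)=\#\{\pi\in S_N:\mathrm{maj}\,\pi\equiv i\pmod k,\ \mathrm{maj}\,\pi^{ -1}\equiv j\pmod l\}$, which equals $\#M_N^{k,l}(i,j)$. Let $O=\{1,3,5,\dots\}$ and $E=\{2,4,6,\dots\}$. For $\pi\in\{12,21\}$, a set $G$ of positive integers and $N'\subseteq S_{n-2}$, $\pi\sqcup\!\sqcup_G^+N'$ is the set of all $\tau\in S_n$ such that the values $1,2$ appear in $\tau$ in the relative order given by $\pi$, at positions $i_1<i_2$ with $i_2-i_1\in G$, and the word obtained from $\tau$ by deleting $1$ and $2$ and subtracting $2$ from every remaining entry lies in $N'$. $\uplus$ denotes disjoint union. -}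

module Defs where

open import Data.Nat using (ℕ; zero; suc; _+_; _*_; _∸_; _^_; _≤_; _<_; _≟_; _≤?_; _<?_; _<ᵇ_; _!)
open import Data.Nat.Properties using (m*n≢0; m^n≢0; _!≢0)
open import Data.Nat.DivMod using (_/_; _%_)
open import Data.List using (List; []; _∷_; length; filter; map; applyUpTo; concatMap)
open import Data.List.Relation.Unary.All using (All; all?)
open import Data.List.Relation.Unary.Unique.DecPropositional _≟_ using (Unique; unique?)
open import Data.Product using (_×_; _,_)
open import Data.Bool using (if_then_else_)
open import Relation.Nullary.Decidable using (_×-dec_; ⌊_⌋)
open import Relation.Binary.PropositionalEquality using (_≡_)
open import Relation.Unary using (Pred; Decidable)
open import Level using (0ℓ)
open import Data.Nat.ListAction using (sum)

-- A permutation π = a₁⋯a_N ∈ S_N is represented by its one-line notation,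
-- the list [a₁, …, a_N] of natural numbers.
-- "w is a permutation of [N] = {1,…,N}"
Perm : ℕ → List ℕ → Set
Perm N w = (length w ≡ N) × All (λ a → (1 ≤ a) × (a ≤ N)) w × Unique w

Perm? : (N : ℕ) → Decidable (Perm N)
Perm? N w = (length w ≟ N) ×-dec (all? (λ a → (1 ≤? a) ×-dec (a ≤? N)) w ×-dec unique? w)

inv : List ℕ → ℕ
inv [] = 0
inv (a ∷ w) = length (filter (_<? a) w) + inv w

-- 0-based position of the first occurrence of x in w (length w if absent)
idx : ℕ → List ℕ → ℕ
idx x [] = 0
idx x (a ∷ w) = if ⌊ x ≟ a ⌋ then 0 else suc (idx x w)

-- imaj π = maj π⁻¹ = Σ i over 1 ≤ i ≤ N-1 such that i+1 appears to the left of i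
imaj : List ℕ → ℕ
imaj w = sum (applyUpTo (λ k → if idx (suc (suc k)) w <ᵇ idx (suc k) w then suc k else 0) (length w ∸ 1))

B : ℕ → ℕ → ℕ → Pred (List ℕ) 0ℓ
B N i j w = Perm N w × (inv w % 2 ≡ i % 2) × (imaj w % 2 ≡ j % 2)

B? : (N i j : ℕ) → Decidable (B N i j)
B? N i j w = Perm? N w ×-dec ((inv w % 2 ≟ i % 2) ×-dec (imaj w % 2 ≟ j % 2))

words : ℕ → ℕ → List (List ℕ)
words k zero = [] ∷ []
words k (suc m) = concatMap (λ a → map (a ∷_) (words k m)) (applyUpTo suc k)

b : ℕ → ℕ → ℕ → ℕ
b N i j = length (filter (B? N i j) (words N N))

O : Pred ℕ 0ℓ
O d = d % 2 ≡ 1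

E : Pred ℕ 0ℓ
E d = (0 < d) × (d % 2 ≡ 0)

data Pat : Set where
  p12 p21 : Pat

Placed : Pat → Pred ℕ 0ℓ → Pred (List ℕ) 0ℓ
Placed p12 G τ = (idx 1 τ < idx 2 τ) × G (idx 2 τ ∸ idx 1 τ)
Placed p21 G τ = (idx 2 τ < idx 1 τ) × G (idx 1 τ ∸ idx 2 τ)

std : List ℕ → List ℕ
std τ = map (_∸ 2) (filter (3 ≤?_) τ)

Shuffle : (n : ℕ) → Pat → Pred ℕ 0ℓ → Pred (List ℕ) 0ℓ → Pred (List ℕ) 0ℓ
Shuffle n π G N' τ = Perm n τ × Placed π G τ × N' (std τ)

nrm : ℕ → ℕ
nrm m = 2 ^ (m ∸ 1) * m !

cEven : ℕ → ℕ → ℕ → ℕ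
cEven m i j = (b (2 * m) i j / nrm m) {{m*n≢0 (2 ^ (m ∸ 1)) (m !) {{m^n≢0 2 (m ∸ 1)}} {{m !≢0}}}}

cOdd : ℕ → ℕ → ℕ → ℕ
cOdd m i j = (b (suc (2 * m)) i j / nrm m) {{m*n≢0 (2 ^ (m ∸ 1)) (m !) {{m^n≢0 2 (m ∸ 1)}} {{m !≢0}}}}

-- Every τ ∈ S (m + 2) arises in exactly one way by inserting 1 and 2, in the order 12 or 21, at
-- positions p and r + 1 (0 ≤ p ≤ r ≤ m) into a permutation σ ∈ S m shifted up by 2. This adds
-- r + p inversions, plus one for the order 21, and changes imaj by an even amount, plus one for the
-- order 21. As the gap r + 1 − p has the parity of r + p + 1, sorting by pattern and gap parity
-- gives (1). Counting the insertions gives b (m + 2) i j = Σ_{0 ≤ p ≤ r ≤ m} F (r + p) with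
-- F s = b m (i + s) j + b m (i + 1 + s) (j + 1); F is 2-periodic, so the double sum is a
-- combination of F 0 and F 1, which gives (2). F is unchanged under (i, j) ↦ (i + 1, j + 1),
-- which is (4); (3) and (5) then follow from (2) by induction on n.

module Submission where

open import Defs
open import Data.Bool using (true; false; if_then_else_)
open import Data.Empty using (⊥-elim)
open import Data.List using (List; []; _∷_; _++_; length; filter; map; concatMap; applyUpTo; downFrom)
open import Data.List.Properties using (length-++; length-map; filter-++; filter-accept; filter-reject; filter-all; filter-none; filter-complete; length-applyUpTo; map-∘; map-id; map-id-local; map-cong; map-cong-local)
open import Data.List.Membership.Propositional using (_∈_; find; lose)
open import Data.List.Membership.Propositional.Properties using (∈-filter⁺; ∈-filter⁻; ∈-map⁺; ∈-map⁻; ∈-++⁺ˡ; ∈-++⁺ʳ; ∈-++⁻; ∈-concatMap⁺; ∈-concatMap⁻; ∈-applyUpTo⁺; ∈-applyUpTo⁻; ∈-downFrom⁺; ∈-downFrom⁻)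
open import Data.List.Membership.Propositional.Properties.WithK using (unique∧set⇒bag)
open import Data.List.Relation.Binary.BagAndSetEquality using (∼bag⇒↭)
open import Data.List.Relation.Binary.Permutation.Propositional.Properties using (↭-length)
open import Data.List.Relation.Unary.All as All using (All; []; _∷_)
open import Data.List.Relation.Unary.All.Properties using (all-filter) renaming (map⁺ to All-map⁺; map⁻ to All-map⁻)
open import Data.List.Relation.Unary.AllPairs using ([]; _∷_)
open import Data.List.Relation.Unary.Any using (here; there)
open import Data.List.Relation.Unary.Unique.Propositional using (Unique)
import Data.List.Relation.Unary.Unique.Propositional.Properties as Unique
open import Data.Nat using (ℕ; zero; suc; pred; _+_; _*_; _∸_; _^_; _!; _≤_; _<_; _<ᵇ_; _≟_; _≤?_; _<?_; _⊔_; _⊓_; z≤n; s≤s; NonZero)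
open import Data.Nat.Properties
open import Data.List.Membership.DecPropositional _≟_ using (_∈?_)
open import Data.Nat.DivMod using (_%_; _/_; %-distribˡ-+; [m+n]%n≡m%n; [m+kn]%n≡m%n; m%n<n; m%n%n≡m%n; m*n/n≡m; m/n*n≡m)
open import Data.Nat.Divisibility using (_∣_; divides; 1∣_)
open import Data.Nat.ListAction using (sum)
open import Data.Nat.Tactic.RingSolver using (solve-∀)
open import Data.Product using (_×_; _,_; proj₁; proj₂; ∃)
open import Data.Sum using (_⊎_; inj₁; inj₂)
open import Function using (_∘_; _∘₂_)
open import Function.Bundles using (mk⇔)
open import Level using (0ℓ)
open import Relation.Binary.PropositionalEquality using (_≡_; _≢_; refl; sym; trans; cong; cong₂; subst; subst₂; ≢-sym; module ≡-Reasoning)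
open import Relation.Nullary using (¬_; yes; no)
open import Relation.Nullary.Decidable using (¬?; _×-dec_)
open import Relation.Unary using (Pred; Decidable; _⊆_; _∪_; _≐_; _⊥_)
open import Relation.Unary.Properties using (⊥-sym)

open ≡-Reasoning

length-unique-≈ : ∀ {A : Set} {xs ys : List A} → Unique xs → Unique ys →
  (∀ {x} → x ∈ xs → x ∈ ys) → (∀ {x} → x ∈ ys → x ∈ xs) → length xs ≡ length ys
length-unique-≈ xs! ys! xs⊆ys ys⊆xs = ↭-length (∼bag⇒↭ (unique∧set⇒bag xs! ys! (mk⇔ xs⊆ys ys⊆xs)))

module _ {A : Set} {P : Pred A 0ℓ} (P? : Decidable P) where

  length-filter-++ : ∀ xs ys → length (filter P? (xs ++ ys)) ≡ length (filter P? xs) + length (filter P? ys)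
  length-filter-++ xs ys = trans (cong length (filter-++ P? xs ys)) (length-++ (filter P? xs))

  length-filter-concatMap : ∀ {B : Set} (f : B → List A) xs →
    length (filter P? (concatMap f xs)) ≡ sum (map (λ x → length (filter P? (f x))) xs)
  length-filter-concatMap f [] = refl
  length-filter-concatMap f (x ∷ xs) =
    trans (length-filter-++ (f x) (concatMap f xs)) (cong (length (filter P? (f x)) +_) (length-filter-concatMap f xs))

  length-filter-map : ∀ {B : Set} (f : B → A) xs → length (filter P? (map f xs)) ≡ length (filter (P? ∘ f) xs)
  length-filter-map f [] = refl
  length-filter-map f (x ∷ xs) with P? (f x)
  ... | yes _ = cong suc (length-filter-map f xs)
  ... | no _ = length-filter-map f xs

  length-filter-cong-local : ∀ {Q : Pred A 0ℓ} (Q? : Decidable Q) xs →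
    (∀ {x} → x ∈ xs → P x → Q x) → (∀ {x} → x ∈ xs → Q x → P x) → length (filter P? xs) ≡ length (filter Q? xs)
  length-filter-cong-local Q? [] P⇒Q Q⇒P = refl
  length-filter-cong-local Q? (x ∷ xs) P⇒Q Q⇒P with P? x | Q? x
  ... | yes _ | yes _ = cong suc (length-filter-cong-local Q? xs (P⇒Q ∘ there) (Q⇒P ∘ there))
  ... | no _ | no _ = length-filter-cong-local Q? xs (P⇒Q ∘ there) (Q⇒P ∘ there)
  ... | yes px | no ¬qx = ⊥-elim (¬qx (P⇒Q (here refl) px))
  ... | no ¬px | yes qx = ⊥-elim (¬px (Q⇒P (here refl) qx))

  length-filter-unique : ∀ {xs ys : List A} → Unique xs → Unique ys →
    (∀ {x} → P x → x ∈ xs → x ∈ ys) → (∀ {x} → P x → x ∈ ys → x ∈ xs) →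
    length (filter P? xs) ≡ length (filter P? ys)
  length-filter-unique xs! ys! xs⊆ys ys⊆xs =
    length-unique-≈ (Unique.filter⁺ P? xs!) (Unique.filter⁺ P? ys!) (transfer xs⊆ys) (transfer ys⊆xs)
    where
    transfer : ∀ {us vs} → (∀ {x} → P x → x ∈ us → x ∈ vs) → ∀ {x} → x ∈ filter P? us → x ∈ filter P? vs
    transfer us⊆vs x∈ with ∈-filter⁻ P? x∈
    ... | x∈us , px = ∈-filter⁺ P? (us⊆vs px x∈us) px

module _ {A B : Set} where

  Unique-map-leftInverse : ∀ (f : A → B) (g : B → A) {xs : List A} →
    (∀ {x} → x ∈ xs → g (f x) ≡ x) → Unique xs → Unique (map f xs)
  Unique-map-leftInverse f g {[]} g∘f≡id [] = []
  Unique-map-leftInverse f g {x ∷ xs} g∘f≡id (x∉xs ∷ xs!) =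
    All.tabulate (λ y∈ fx≡y → let (z , z∈xs , y≡fz) = ∈-map⁻ f y∈ in
      All.lookup x∉xs z∈xs (trans (sym (g∘f≡id (here refl))) (trans (cong g (trans fx≡y y≡fz)) (g∘f≡id (there z∈xs)))))
    ∷ Unique-map-leftInverse f g (g∘f≡id ∘ there) xs!

  Unique-concatMap : ∀ (f : A → List B) (decode : B → A) {xs : List A} → Unique xs →
    (∀ {x} → x ∈ xs → Unique (f x)) → (∀ {x y} → x ∈ xs → y ∈ f x → decode y ≡ x) → Unique (concatMap f xs)
  Unique-concatMap f decode {[]} [] f! decode-f = []
  Unique-concatMap f decode {x ∷ xs} (x∉xs ∷ xs!) f! decode-f =
    Unique.++⁺ (f! (here refl)) (Unique-concatMap f decode xs! (f! ∘ there) (decode-f ∘ there)) disjoint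
    where
    disjoint : ∀ {y} → ¬ (y ∈ f x × y ∈ concatMap f xs)
    disjoint (y∈fx , y∈rest) with find (∈-concatMap⁻ f y∈rest)
    ... | z , z∈xs , y∈fz = All.lookup x∉xs z∈xs (trans (sym (decode-f (here refl) y∈fx)) (decode-f (there z∈xs) y∈fz))

sum-map-cong-local : ∀ {A : Set} {f g : A → ℕ} (xs : List A) → (∀ {x} → x ∈ xs → f x ≡ g x) → sum (map f xs) ≡ sum (map g xs)
sum-map-cong-local xs f≡g = cong sum (map-cong-local (All.tabulate f≡g))

infix 4 _≡₂_
record _≡₂_ (a c : ℕ) : Set where
  constructor mod2
  field %2-≡ : a % 2 ≡ c % 2
open _≡₂_

≡₂-refl : ∀ {a} → a ≡₂ a
≡₂-refl = mod2 refl

≡₂-reflexive : ∀ {a c} → a ≡ c → a ≡₂ c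
≡₂-reflexive refl = ≡₂-refl

≡₂-sym : ∀ {a c} → a ≡₂ c → c ≡₂ a
≡₂-sym (mod2 e) = mod2 (sym e)

≡₂-trans : ∀ {a c d} → a ≡₂ c → c ≡₂ d → a ≡₂ d
≡₂-trans (mod2 e) (mod2 f) = mod2 (trans e f)

≡₂-+ : ∀ {a b c d} → a ≡₂ b → c ≡₂ d → a + c ≡₂ b + d
≡₂-+ {a} {b} {c} {d} (mod2 a≡b) (mod2 c≡d) = mod2 (begin
  (a + c) % 2          ≡⟨ %-distribˡ-+ a c 2 ⟩
  (a % 2 + c % 2) % 2  ≡⟨ cong₂ (λ x y → (x + y) % 2) a≡b c≡d ⟩
  (b % 2 + d % 2) % 2  ≡⟨ %-distribˡ-+ b d 2 ⟨
  (b + d) % 2          ∎)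

≡₂-suc : ∀ {a c} → a ≡₂ c → suc a ≡₂ suc c
≡₂-suc = ≡₂-+ {1} {1} ≡₂-refl

≡₂-+ˡ : ∀ m {c d} → c ≡₂ d → m + c ≡₂ m + d
≡₂-+ˡ m = ≡₂-+ {m} {m} ≡₂-refl

2+m≡₂m : ∀ m → suc (suc m) ≡₂ m
2+m≡₂m m = mod2 (trans (cong (_% 2) (+-comm 2 m)) ([m+n]%n≡m%n m 2))

m+2n≡₂m : ∀ m n → m + 2 * n ≡₂ m
m+2n≡₂m m n = mod2 (trans (cong (λ x → (m + x) % 2) (*-comm 2 n)) ([m+kn]%n≡m%n m n 2))

m+n+n≡₂m : ∀ m n → m + n + n ≡₂ m
m+n+n≡₂m m n = ≡₂-trans (≡₂-reflexive m+n+n≡m+2n) (m+2n≡₂m m n)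
  where
  m+n+n≡m+2n : m + n + n ≡ m + 2 * n
  m+n+n≡m+2n = trans (+-assoc m n n) (cong (λ x → m + (n + x)) (sym (+-identityʳ n)))

m%2≡₂m : ∀ m → m % 2 ≡₂ m
m%2≡₂m m = mod2 (m%n%n≡m%n m 2)

m+n≡₂k⇒m≡₂k+n : ∀ {m n k} → m + n ≡₂ k → m ≡₂ k + n
m+n≡₂k⇒m≡₂k+n {m} {n} m+n≡k = ≡₂-trans (≡₂-sym (m+n+n≡₂m m n)) (≡₂-+ m+n≡k ≡₂-refl)

m≡₂k+n⇒m+n≡₂k : ∀ {m n k} → m ≡₂ k + n → m + n ≡₂ k
m≡₂k+n⇒m+n≡₂k m≡k+n = ≡₂-sym (m+n≡₂k⇒m≡₂k+n (≡₂-sym m≡k+n))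

+-cancelʳ-≡₂ : ∀ {m k} n → m + n ≡₂ k + n → m ≡₂ k
+-cancelʳ-≡₂ {m} {k} n m+n≡k+n = ≡₂-trans (m+n≡₂k⇒m≡₂k+n m+n≡k+n) (m+n+n≡₂m k n)

parity : ∀ m → m % 2 ≡ 0 ⊎ m % 2 ≡ 1
parity m with m % 2 | m%n<n m 2
... | 0 | _ = inj₁ refl
... | 1 | _ = inj₂ refl
... | suc (suc _) | s≤s (s≤s ())

gap-sum : ∀ {p r} i → p ≤ r → i + (r + p) + (suc r ∸ p) ≡₂ suc i
gap-sum {p} {r} i p≤r = ≡₂-trans (≡₂-reflexive sum≡) (≡₂-suc (m+n+n≡₂m i r))
  where
  sum≡ : i + (r + p) + (suc r ∸ p) ≡ suc (i + r + r)
  sum≡ = begin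
    i + (r + p) + (suc r ∸ p)    ≡⟨ trans (+-assoc i (r + p) _) (cong (i +_) (+-assoc r p _)) ⟩
    i + (r + (p + (suc r ∸ p)))  ≡⟨ cong (λ x → i + (r + x)) (m+[n∸m]≡n (m≤n⇒m≤1+n p≤r)) ⟩
    i + (r + suc r)              ≡⟨ trans (cong (i +_) (+-suc r r)) (+-suc i (r + r)) ⟩
    suc (i + (r + r))            ≡⟨ cong suc (+-assoc i r r) ⟨
    suc (i + r + r)              ∎

odd-gap : ∀ {p r} i → p ≤ r → O (suc r ∸ p) → i + (r + p) ≡₂ i
odd-gap i p≤r odd = +-cancelʳ-≡₂ 1
  (≡₂-trans (≡₂-sym (≡₂-+ˡ (i + _) (mod2 odd))) (≡₂-trans (gap-sum i p≤r) (≡₂-reflexive (+-comm 1 i))))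

even-gap : ∀ {p r} i → p ≤ r → E (suc r ∸ p) → i + (r + p) ≡₂ suc i
even-gap i p≤r (_ , even) = ≡₂-trans (≡₂-reflexive (sym (+-identityʳ _)))
  (≡₂-trans (≡₂-sym (≡₂-+ˡ (i + _) (mod2 even))) (gap-sum i p≤r))

gap-positive : ∀ {p r} → p ≤ r → 0 < suc r ∸ p
gap-positive p≤r = m<n⇒0<n∸m (s≤s p≤r)

O⊎E : ∀ {g} → 0 < g → O g ⊎ E g
O⊎E {g} 0<g with parity g
... | inj₁ even = inj₂ (0<g , even)
... | inj₂ odd = inj₁ odd

O⇒¬E : ∀ {g} → O g → ¬ E g
O⇒¬E odd (_ , even) = 1+n≢0 (trans (sym odd) even)

-- Summing a 2-periodic function over 0 ≤ p ≤ r ≤ m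

pairSum : (ℕ → ℕ) → ℕ → ℕ
pairSum F m = sum (map (λ r → sum (map (λ p → F (r + p)) (downFrom (suc r)))) (downFrom (suc m)))

pairSum-cong : ∀ {F G} m → (∀ s → F s ≡ G s) → pairSum F m ≡ pairSum G m
pairSum-cong m F≡G = cong sum (map-cong (λ r → cong sum (map-cong (λ p → F≡G (r + p)) (downFrom (suc r)))) (downFrom (suc m)))

double : ℕ → ℕ
double zero = 0
double (suc n) = suc (suc (double n))

2*n≡double : ∀ n → 2 * n ≡ double n
2*n≡double zero = refl
2*n≡double (suc n) = begin
  suc n + (suc n + 0)  ≡⟨ +-suc (suc n) (n + 0) ⟩
  suc (suc (n + (n + 0)))  ≡⟨ cong (suc ∘ suc) (2*n≡double n) ⟩
  suc (suc (double n))  ∎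

module _ (F : ℕ → ℕ) (F-periodic : ∀ x → F (2 + x) ≡ F x) where

  private
    rowSum : ℕ → ℕ → ℕ
    rowSum s c = sum (map (λ p → F (s + p)) (downFrom c))

    F-double+ : ∀ c x → F (double c + x) ≡ F x
    F-double+ zero x = refl
    F-double+ (suc c) x = trans (F-periodic (double c + x)) (F-double+ c x)

    F-suc+F : ∀ x → F (suc x) + F x ≡ F 1 + F 0
    F-suc+F zero = refl
    F-suc+F (suc x) = trans (cong (_+ F (suc x)) (F-periodic x)) (trans (+-comm (F x) (F (suc x))) (F-suc+F x))

    rowSum-double : ∀ s c → rowSum s (double c) ≡ c * (F 1 + F 0)
    rowSum-double s zero = refl
    rowSum-double s (suc c) = begin
      F (s + suc (double c)) + (F (s + double c) + rowSum s (double c))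
        ≡⟨ +-assoc (F (s + suc (double c))) _ _ ⟨
      F (s + suc (double c)) + F (s + double c) + rowSum s (double c)
        ≡⟨ cong₂ _+_ (trans (cong (λ x → F x + F (s + double c)) (+-suc s (double c))) (F-suc+F (s + double c))) (rowSum-double s c) ⟩
      F 1 + F 0 + c * (F 1 + F 0)  ∎

    row-double : ∀ k → rowSum (double k) (suc (double k)) ≡ F 0 + k * (F 1 + F 0)
    row-double k = cong₂ _+_ F[double+double]≡F0 (rowSum-double (double k) k)
      where
      F[double+double]≡F0 : F (double k + double k) ≡ F 0
      F[double+double]≡F0 = trans (F-double+ k (double k)) (trans (cong F (sym (+-identityʳ (double k)))) (F-double+ k 0))

  pairSum-double : ∀ k → pairSum F (double k) ≡ (suc k * suc k) * F 0 + (suc k * k) * F 1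
  pairSum-double+1 : ∀ k → pairSum F (suc (double k)) ≡ (suc k * suc (suc k)) * F 0 + (suc k * suc k) * F 1

  pairSum-double zero = arith (F 0) (F 1)
    where
    arith : ∀ a c → a + 0 + 0 ≡ 1 * 1 * a + 1 * 0 * c
    arith = solve-∀
  pairSum-double (suc k) = trans (cong₂ _+_ (row-double (suc k)) (pairSum-double+1 k)) (arith k (F 0) (F 1))
    where
    arith : ∀ k a c → a + suc k * (c + a) + (suc k * suc (suc k) * a + suc k * suc k * c)
                    ≡ suc (suc k) * suc (suc k) * a + suc (suc k) * suc k * c
    arith = solve-∀
  pairSum-double+1 k = trans (cong₂ _+_ (rowSum-double (suc (double k)) (suc k)) (pairSum-double k)) (arith k (F 0) (F 1))
    where
    arith : ∀ k a c → suc k * (c + a) + (suc k * suc k * a + suc k * k * c) ≡ suc k * suc (suc k) * a + suc k * suc k * c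
    arith = solve-∀

insAt : ∀ {A : Set} → ℕ → A → List A → List A
insAt zero x w = x ∷ w
insAt (suc k) x [] = x ∷ []
insAt (suc k) x (a ∷ w) = a ∷ insAt k x w

module _ {A : Set} where

  length-insAt : ∀ k (x : A) w → length (insAt k x w) ≡ suc (length w)
  length-insAt zero x w = refl
  length-insAt (suc k) x [] = refl
  length-insAt (suc k) x (a ∷ w) = cong suc (length-insAt k x w)

  All-insAt⁺ : ∀ {P : Pred A 0ℓ} k {x : A} {w} → P x → All P w → All P (insAt k x w)
  All-insAt⁺ zero px pw = px ∷ pw
  All-insAt⁺ (suc k) {w = []} px [] = px ∷ []
  All-insAt⁺ (suc k) {w = a ∷ w} px (pa ∷ pw) = pa ∷ All-insAt⁺ k px pw

  All-insAt⁻ : ∀ {P : Pred A 0ℓ} k {x : A} {w} → All P (insAt k x w) → P x × All P w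
  All-insAt⁻ zero (px ∷ pw) = px , pw
  All-insAt⁻ (suc k) {w = []} (px ∷ []) = px , []
  All-insAt⁻ (suc k) {w = a ∷ w} (pa ∷ pxw) = let (px , pw) = All-insAt⁻ k pxw in px , pa ∷ pw

  Unique-insAt⁺ : ∀ k {x : A} {w} → All (x ≢_) w → Unique w → Unique (insAt k x w)
  Unique-insAt⁺ zero x∉w w! = x∉w ∷ w!
  Unique-insAt⁺ (suc k) {w = []} [] [] = [] ∷ []
  Unique-insAt⁺ (suc k) {w = a ∷ w} (x≢a ∷ x∉w) (a∉w ∷ w!) =
    All-insAt⁺ k (≢-sym x≢a) a∉w ∷ Unique-insAt⁺ k x∉w w!

  Unique-insAt⁻ : ∀ k {x : A} {w} → Unique (insAt k x w) → Unique w
  Unique-insAt⁻ zero (_ ∷ w!) = w!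
  Unique-insAt⁻ (suc k) {w = []} _ = []
  Unique-insAt⁻ (suc k) {w = a ∷ w} (a∉xw ∷ xw!) = proj₂ (All-insAt⁻ k a∉xw) ∷ Unique-insAt⁻ k xw!

  insAt-comm : ∀ i k (x y : A) u → k ≤ i → i ≤ length u → insAt (suc i) x (insAt k y u) ≡ insAt k y (insAt i x u)
  insAt-comm i zero x y u _ _ = refl
  insAt-comm (suc i) (suc k) x y (a ∷ u) (s≤s k≤i) (s≤s i≤u) = cong (a ∷_) (insAt-comm i k x y u k≤i i≤u)

  module _ {P : Pred A 0ℓ} (P? : Decidable P) where

    filter-insAt-reject : ∀ k {x} w → ¬ P x → filter P? (insAt k x w) ≡ filter P? w
    filter-insAt-reject zero w ¬px = filter-reject P? ¬px
    filter-insAt-reject (suc k) [] ¬px = filter-reject P? ¬px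
    filter-insAt-reject (suc k) (a ∷ w) ¬px with P? a
    ... | yes _ = cong (a ∷_) (filter-insAt-reject k w ¬px)
    ... | no _ = filter-insAt-reject k w ¬px

    length-filter-insAt : ∀ k x w → length (filter P? (insAt k x w)) ≡ length (filter P? (x ∷ [])) + length (filter P? w)
    length-filter-insAt zero x w with P? x
    ... | yes _ = refl
    ... | no _ = refl
    length-filter-insAt (suc k) x [] = sym (+-identityʳ _)
    length-filter-insAt (suc k) x (a ∷ w) with P? a
    ... | yes _ = trans (cong suc (length-filter-insAt k x w)) (sym (+-suc (length (filter P? (x ∷ []))) _))
    ... | no _ = length-filter-insAt k x w

idx-here : ∀ {x a} w → x ≡ a → idx x (a ∷ w) ≡ 0
idx-here {x} {a} w x≡a with x ≟ a
... | yes _ = refl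
... | no x≢a = ⊥-elim (x≢a x≡a)

idx-there : ∀ {x a} w → x ≢ a → idx x (a ∷ w) ≡ suc (idx x w)
idx-there {x} {a} w x≢a with x ≟ a
... | yes x≡a = ⊥-elim (x≢a x≡a)
... | no _ = refl

idx<length : ∀ {x w} → x ∈ w → idx x w < length w
idx<length {x} {a ∷ w} x∈ with x ≟ a | x∈
... | yes _ | _ = s≤s z≤n
... | no x≢a | here x≡a = ⊥-elim (x≢a x≡a)
... | no _ | there x∈w = s≤s (idx<length x∈w)

<ᵇ-true : ∀ {m n} → m < n → (m <ᵇ n) ≡ true
<ᵇ-true {zero} (s≤s _) = refl
<ᵇ-true {suc m} (s≤s m<n) = <ᵇ-true m<n

<ᵇ-false : ∀ {m n} → n ≤ m → (m <ᵇ n) ≡ false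
<ᵇ-false z≤n = refl
<ᵇ-false (s≤s n≤m) = <ᵇ-false n≤m

-- Where a position v of w ends up after inserting at position k.
punchIn : ℕ → ℕ → ℕ
punchIn zero v = suc v
punchIn (suc k) zero = zero
punchIn (suc k) (suc v) = suc (punchIn k v)

punchIn-<ᵇ : ∀ k a c → (punchIn k a <ᵇ punchIn k c) ≡ (a <ᵇ c)
punchIn-<ᵇ zero a c = refl
punchIn-<ᵇ (suc k) zero zero = refl
punchIn-<ᵇ (suc k) zero (suc c) = refl
punchIn-<ᵇ (suc k) (suc a) zero = refl
punchIn-<ᵇ (suc k) (suc a) (suc c) = punchIn-<ᵇ k a c

punchIn-≥ : ∀ {k v} → k ≤ v → punchIn k v ≡ suc v
punchIn-≥ z≤n = refl
punchIn-≥ (s≤s k≤v) = cong suc (punchIn-≥ k≤v)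

idx-insAt : ∀ k {x w} → All (x ≢_) w → k ≤ length w → idx x (insAt k x w) ≡ k
idx-insAt zero {w = w} _ _ = idx-here w refl
idx-insAt (suc k) {w = a ∷ w} (x≢a ∷ x∉w) (s≤s k≤w) =
  trans (idx-there (insAt k _ w) x≢a) (cong suc (idx-insAt k x∉w k≤w))

idx-insAt-≢ : ∀ k {x y w} → x ≢ y → k ≤ length w → idx x (insAt k y w) ≡ punchIn k (idx x w)
idx-insAt-≢ zero {w = w} x≢y _ = idx-there w x≢y
idx-insAt-≢ (suc k) {x} {w = a ∷ w} x≢y (s≤s k≤w) with x ≟ a
... | yes _ = refl
... | no _ = cong suc (idx-insAt-≢ k x≢y k≤w)

idx-map-2+ : ∀ v w → idx (2 + v) (map (2 +_) w) ≡ idx v w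
idx-map-2+ v [] = refl
idx-map-2+ v (a ∷ w) with v ≟ a
... | yes v≡a = idx-here (map (2 +_) w) (cong (2 +_) v≡a)
... | no v≢a = trans (idx-there (map (2 +_) w) (v≢a ∘ +-cancelˡ-≡ 2 v a)) (cong suc (idx-map-2+ v w))

insAt-idx : ∀ {Q : Pred ℕ 0ℓ} (Q? : Decidable Q) {x w} → Unique w → x ∈ w → ¬ Q x →
  (∀ {y} → y ∈ w → y ≢ x → Q y) → w ≡ insAt (idx x w) x (filter Q? w)
insAt-idx Q? {x} {a ∷ w} (a∉w ∷ w!) x∈ ¬qx others with x ≟ a | x∈
... | yes refl | _ = cong (x ∷_) (sym (trans (filter-reject Q? ¬qx)
        (filter-all Q? (All.tabulate (λ y∈w → others (there y∈w) (λ y≡x → All.lookup a∉w y∈w (sym y≡x)))))))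
... | no x≢a | here x≡a = ⊥-elim (x≢a x≡a)
... | no x≢a | there x∈w = trans (cong (a ∷_) (insAt-idx Q? w! x∈w ¬qx (others ∘ there)))
        (cong (insAt (suc (idx x w)) x) (sym (filter-accept Q? (others (here refl) (≢-sym x≢a)))))

inv-insAt-min : ∀ k {x w} → All (x <_) w → k ≤ length w → inv (insAt k x w) ≡ inv w + k
inv-insAt-min zero {x} {w} x<w _ = begin
  length (filter (_<? x) w) + inv w  ≡⟨ cong (λ v → length v + inv w) (filter-none (_<? x) (All.map <⇒≯ x<w)) ⟩
  inv w                               ≡⟨ +-identityʳ (inv w) ⟨
  inv w + 0                           ∎
inv-insAt-min (suc k) {x} {a ∷ w} (x<a ∷ x<w) (s≤s k≤w) = begin
  length (filter (_<? a) (insAt k x w)) + inv (insAt k x w)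
    ≡⟨ cong₂ _+_ (length-filter-insAt (_<? a) k x w) (inv-insAt-min k x<w k≤w) ⟩
  length (filter (_<? a) (x ∷ [])) + c + (inv w + k)
    ≡⟨ cong (λ v → length v + c + (inv w + k)) (filter-accept (_<? a) x<a) ⟩
  suc c + (inv w + k)
    ≡⟨ rearrange c (inv w) k ⟩
  c + inv w + suc k  ∎
  where
  c : ℕ
  c = length (filter (_<? a) w)
  rearrange : ∀ c i k → suc c + (i + k) ≡ c + i + suc k
  rearrange = solve-∀

inv-insAt-insAt : ∀ p r {x y w} → All (x <_) w → p ≤ r → r ≤ length w →
  inv (insAt p x (insAt r y w)) ≡ inv (insAt r y w) + p + length (filter (_<? x) (y ∷ []))
inv-insAt-insAt zero r {x} {y} {w} x<w _ _ = begin
  length (filter (_<? x) (insAt r y w)) + inv (insAt r y w)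
    ≡⟨ cong (_+ inv (insAt r y w)) (length-filter-insAt (_<? x) r y w) ⟩
  cy + length (filter (_<? x) w) + inv (insAt r y w)
    ≡⟨ cong (λ v → cy + length v + inv (insAt r y w)) (filter-none (_<? x) (All.map <⇒≯ x<w)) ⟩
  cy + 0 + inv (insAt r y w)
    ≡⟨ rearrange cy (inv (insAt r y w)) ⟩
  inv (insAt r y w) + 0 + cy  ∎
  where
  cy : ℕ
  cy = length (filter (_<? x) (y ∷ []))
  rearrange : ∀ c i → c + 0 + i ≡ i + 0 + c
  rearrange = solve-∀
inv-insAt-insAt (suc p) (suc r) {x} {y} {a ∷ w} (x<a ∷ x<w) (s≤s p≤r) (s≤s r≤w) = begin
  length (filter (_<? a) (insAt p x w′)) + inv (insAt p x w′)
    ≡⟨ cong₂ _+_ (length-filter-insAt (_<? a) p x w′) (inv-insAt-insAt p r x<w p≤r r≤w) ⟩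
  length (filter (_<? a) (x ∷ [])) + c + (inv w′ + p + cy)
    ≡⟨ cong (λ v → length v + c + (inv w′ + p + cy)) (filter-accept (_<? a) x<a) ⟩
  suc c + (inv w′ + p + cy)
    ≡⟨ rearrange c (inv w′) p cy ⟩
  c + inv w′ + suc p + cy  ∎
  where
  w′ : List ℕ
  w′ = insAt r y w
  c : ℕ
  c = length (filter (_<? a) w′)
  cy : ℕ
  cy = length (filter (_<? x) (y ∷ []))
  rearrange : ∀ c i p e → suc c + (i + p + e) ≡ c + i + suc p + e
  rearrange = solve-∀

inv-map-2+ : ∀ σ → inv (map (2 +_) σ) ≡ inv σ
inv-map-2+ [] = refl
inv-map-2+ (a ∷ σ) = cong₂ _+_ smaller≡ (inv-map-2+ σ)
  where
  smaller≡ : length (filter (_<? 2 + a) (map (2 +_) σ)) ≡ length (filter (_<? a) σ)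
  smaller≡ = trans (length-filter-map (_<? 2 + a) (2 +_) σ)
    (length-filter-cong-local _ (_<? a) σ (λ _ → ≤-pred ∘ ≤-pred) (λ _ → s≤s ∘ s≤s))

-- Shuffling 1 and 2 into a shifted permutation

leftValue rightValue : Pat → ℕ
leftValue p12 = 1
leftValue p21 = 2
rightValue p12 = 2
rightValue p21 = 1

leftValue-bounds : ∀ o → 1 ≤ leftValue o × leftValue o ≤ 2
leftValue-bounds p12 = s≤s z≤n , s≤s z≤n
leftValue-bounds p21 = s≤s z≤n , s≤s (s≤s z≤n)

rightValue-bounds : ∀ o → 1 ≤ rightValue o × rightValue o ≤ 2
rightValue-bounds p12 = s≤s z≤n , s≤s (s≤s z≤n)
rightValue-bounds p21 = s≤s z≤n , s≤s z≤n

leftValue≢rightValue : ∀ o → leftValue o ≢ rightValue o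
leftValue≢rightValue p12 ()
leftValue≢rightValue p21 ()

-- The extra inversion (or inverse descent) created by the pair {1, 2} in pattern o.
bump : Pat → ℕ → ℕ
bump p12 x = x
bump p21 x = suc x

bump-inversion : ∀ o x → x + length (filter (_<? leftValue o) (rightValue o ∷ [])) ≡ bump o x
bump-inversion p12 x = +-identityʳ x
bump-inversion p21 x = +-comm x 1

bump-+ : ∀ o x y → bump o x + y ≡ bump o (x + y)
bump-+ p12 x y = refl
bump-+ p21 x y = refl

bump-≡₂ : ∀ o {x y} → bump o x ≡₂ y → x ≡₂ bump o y
bump-≡₂ p12 x≡y = x≡y
bump-≡₂ p21 {x} sx≡y = ≡₂-trans (≡₂-sym (2+m≡₂m x)) (≡₂-suc sx≡y)

-- leftValue o lands at position p and rightValue o at position r + 1; the rest is σ shifted up by 2.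
shuffle : Pat → ℕ → ℕ → List ℕ → List ℕ
shuffle o p r σ = insAt p (leftValue o) (insAt r (rightValue o) (map (2 +_) σ))

length-shuffle : ∀ o p r σ → length (shuffle o p r σ) ≡ 2 + length σ
length-shuffle o p r σ = trans (length-insAt p _ _) (cong suc (trans (length-insAt r _ _) (cong suc (length-map (2 +_) σ))))

map-2+≥3 : ∀ {σ} → All (1 ≤_) σ → All (3 ≤_) (map (2 +_) σ)
map-2+≥3 σ≥1 = All-map⁺ (All.map (s≤s ∘ s≤s) σ≥1)

All≥3⇒All≢ : ∀ {x w} → x ≤ 2 → All (3 ≤_) w → All (x ≢_) w
All≥3⇒All≢ x≤2 w≥3 = All.map (λ 3≤a x≡a → <⇒≱ (s≤s x≤2) (subst (3 ≤_) (sym x≡a) 3≤a)) w≥3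

std-shuffle : ∀ o p r {σ} → All (1 ≤_) σ → std (shuffle o p r σ) ≡ σ
std-shuffle o p r {σ} σ≥1 = begin
  map (_∸ 2) (filter (3 ≤?_) (shuffle o p r σ))
    ≡⟨ cong (map (_∸ 2)) (filter-insAt-reject (3 ≤?_) p _ (<⇒≱ (s≤s (proj₂ (leftValue-bounds o))))) ⟩
  map (_∸ 2) (filter (3 ≤?_) (insAt r (rightValue o) (map (2 +_) σ)))
    ≡⟨ cong (map (_∸ 2)) (filter-insAt-reject (3 ≤?_) r _ (<⇒≱ (s≤s (proj₂ (rightValue-bounds o))))) ⟩
  map (_∸ 2) (filter (3 ≤?_) (map (2 +_) σ))
    ≡⟨ cong (map (_∸ 2)) (filter-all (3 ≤?_) (map-2+≥3 σ≥1)) ⟩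
  map (_∸ 2) (map (2 +_) σ)
    ≡⟨ trans (sym (map-∘ σ)) (map-id σ) ⟩
  σ ∎

Perm-shuffle⁺ : ∀ o p r {m σ} → Perm m σ → Perm (2 + m) (shuffle o p r σ)
Perm-shuffle⁺ o p r {m} {σ} (len , bounds , σ!) =
  trans (length-shuffle o p r σ) (cong (2 +_) len) ,
  All-insAt⁺ p (value-bounds (leftValue-bounds o)) (All-insAt⁺ r (value-bounds (rightValue-bounds o))
    (All-map⁺ (All.map (λ (_ , a≤m) → s≤s z≤n , s≤s (s≤s a≤m)) bounds))) ,
  Unique-insAt⁺ p (All-insAt⁺ r (leftValue≢rightValue o) (All≥3⇒All≢ (proj₂ (leftValue-bounds o)) W≥3))
    (Unique-insAt⁺ r (All≥3⇒All≢ (proj₂ (rightValue-bounds o)) W≥3) (Unique.map⁺ (+-cancelˡ-≡ 2 _ _) σ!))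
  where
  W≥3 : All (3 ≤_) (map (2 +_) σ)
  W≥3 = map-2+≥3 (All.map proj₁ bounds)
  value-bounds : ∀ {v} → 1 ≤ v × v ≤ 2 → 1 ≤ v × v ≤ 2 + m
  value-bounds (1≤v , v≤2) = 1≤v , ≤-trans v≤2 (m≤m+n 2 m)

Perm-shuffle⁻ : ∀ o p r {m σ} → All (1 ≤_) σ → Perm (2 + m) (shuffle o p r σ) → Perm m σ
Perm-shuffle⁻ o p r {m} {σ} σ≥1 (len , bounds , τ!) =
  suc-injective (suc-injective (trans (sym (length-shuffle o p r σ)) len)) ,
  All.zipWith (λ (1≤a , (_ , a+2≤m+2)) → 1≤a , ≤-pred (≤-pred a+2≤m+2))
    (σ≥1 , All-map⁻ (proj₂ (All-insAt⁻ r (proj₂ (All-insAt⁻ p bounds))))) ,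
  Unique.map⁻ (Unique-insAt⁻ r (Unique-insAt⁻ p τ!))

-- imaj w is the sum of descent w k over k < length w ∸ 1.
descent : List ℕ → ℕ → ℕ
descent w k = if idx (suc (suc k)) w <ᵇ idx (suc k) w then suc k else 0

module _ (o : Pat) {p r : ℕ} {σ : List ℕ} (σ≥1 : All (1 ≤_) σ) (p≤r : p ≤ r) (r≤σ : r ≤ length σ) where

  private
    W W′ : List ℕ
    W = map (2 +_) σ
    W′ = insAt r (rightValue o) W
    W≥3 : All (3 ≤_) W
    W≥3 = map-2+≥3 σ≥1
    r≤W : r ≤ length W
    r≤W = subst (r ≤_) (sym (length-map (2 +_) σ)) r≤σ
    p≤W′ : p ≤ length W′
    p≤W′ = subst (p ≤_) (sym (length-insAt r _ W)) (≤-trans p≤r (m≤n⇒m≤1+n r≤W))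

  idx-left : idx (leftValue o) (shuffle o p r σ) ≡ p
  idx-left = idx-insAt p (All-insAt⁺ r (leftValue≢rightValue o) (All≥3⇒All≢ (proj₂ (leftValue-bounds o)) W≥3)) p≤W′

  idx-right : idx (rightValue o) (shuffle o p r σ) ≡ suc r
  idx-right = begin
    idx (rightValue o) (shuffle o p r σ)  ≡⟨ idx-insAt-≢ p (≢-sym (leftValue≢rightValue o)) p≤W′ ⟩
    punchIn p (idx (rightValue o) W′)      ≡⟨ cong (punchIn p) (idx-insAt r (All≥3⇒All≢ (proj₂ (rightValue-bounds o)) W≥3) r≤W) ⟩
    punchIn p r                            ≡⟨ punchIn-≥ p≤r ⟩
    suc r                                  ∎

  idx-shuffle-3+ : ∀ v → idx (3 + v) (shuffle o p r σ) ≡ punchIn p (punchIn r (idx (suc v) σ))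
  idx-shuffle-3+ v = begin
    idx (3 + v) (shuffle o p r σ)          ≡⟨ idx-insAt-≢ p (≥3-≢ (proj₂ (leftValue-bounds o))) p≤W′ ⟩
    punchIn p (idx (3 + v) W′)             ≡⟨ cong (punchIn p) (idx-insAt-≢ r (≥3-≢ (proj₂ (rightValue-bounds o))) r≤W) ⟩
    punchIn p (punchIn r (idx (3 + v) W))  ≡⟨ cong (punchIn p ∘ punchIn r) (idx-map-2+ (suc v) σ) ⟩
    punchIn p (punchIn r (idx (suc v) σ))  ∎
    where
    ≥3-≢ : ∀ {x} → x ≤ 2 → 3 + v ≢ x
    ≥3-≢ x≤2 3+v≡x = <⇒≱ (s≤s x≤2) (subst (3 ≤_) 3+v≡x (m≤m+n 3 v))

  inv-shuffle : inv (shuffle o p r σ) ≡ bump o (inv σ + (r + p))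
  inv-shuffle = begin
    inv (shuffle o p r σ)
      ≡⟨ inv-insAt-insAt p r (All.map (<-≤-trans (s≤s (proj₂ (leftValue-bounds o)))) W≥3) p≤r r≤W ⟩
    inv W′ + p + c
      ≡⟨ cong (λ x → x + p + c) (inv-insAt-min r (All.map (<-≤-trans (s≤s (proj₂ (rightValue-bounds o)))) W≥3) r≤W) ⟩
    inv W + r + p + c
      ≡⟨ cong (λ x → x + r + p + c) (inv-map-2+ σ) ⟩
    inv σ + r + p + c
      ≡⟨ cong (_+ c) (+-assoc (inv σ) r p) ⟩
    inv σ + (r + p) + c
      ≡⟨ bump-inversion o (inv σ + (r + p)) ⟩
    bump o (inv σ + (r + p))  ∎
    where
    c : ℕ
    c = length (filter (_<? leftValue o) (rightValue o ∷ []))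

  descent-shuffle-2+ : ∀ k → descent (shuffle o p r σ) (2 + k) ≡₂ descent σ k
  descent-shuffle-2+ k = ≡₂-trans (≡₂-reflexive (cong (λ c → if c then 3 + k else 0) order≡)) (if-2+ _ (suc k))
    where
    order≡ : (idx (4 + k) (shuffle o p r σ) <ᵇ idx (3 + k) (shuffle o p r σ)) ≡ (idx (2 + k) σ <ᵇ idx (1 + k) σ)
    order≡ = trans (cong₂ _<ᵇ_ (idx-shuffle-3+ (suc k)) (idx-shuffle-3+ k)) (trans (punchIn-<ᵇ p _ _) (punchIn-<ᵇ r _ _))
    if-2+ : ∀ c x → (if c then 2 + x else 0) ≡₂ (if c then x else 0)
    if-2+ true x = 2+m≡₂m x
    if-2+ false x = ≡₂-refl

descent-shuffle-0 : ∀ o {p r σ} → All (1 ≤_) σ → p ≤ r → r ≤ length σ → descent (shuffle o p r σ) 0 ≡ bump o 0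
descent-shuffle-0 p12 σ≥1 p≤r r≤σ = trans
  (cong₂ (λ a c → if a <ᵇ c then 1 else 0) (idx-right p12 σ≥1 p≤r r≤σ) (idx-left p12 σ≥1 p≤r r≤σ))
  (cong (λ c → if c then 1 else 0) (<ᵇ-false (m≤n⇒m≤1+n p≤r)))
descent-shuffle-0 p21 σ≥1 p≤r r≤σ = trans
  (cong₂ (λ a c → if a <ᵇ c then 1 else 0) (idx-left p21 σ≥1 p≤r r≤σ) (idx-right p21 σ≥1 p≤r r≤σ))
  (cong (λ c → if c then 1 else 0) (<ᵇ-true (s≤s p≤r)))

sum-applyUpTo-≡₂ : ∀ {f g : ℕ → ℕ} n → (∀ k → f k ≡₂ g k) → sum (applyUpTo f n) ≡₂ sum (applyUpTo g n)
sum-applyUpTo-≡₂ zero f≡g = ≡₂-refl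
sum-applyUpTo-≡₂ (suc n) f≡g = ≡₂-+ (f≡g 0) (sum-applyUpTo-≡₂ n (f≡g ∘ suc))

imaj-shuffle : ∀ o {p r σ} → All (1 ≤_) σ → p ≤ r → r ≤ length σ → imaj (shuffle o p r σ) ≡₂ bump o (imaj σ)
imaj-shuffle p12 {σ = []} _ z≤n z≤n = ≡₂-refl
imaj-shuffle p21 {σ = []} _ z≤n z≤n = ≡₂-refl
imaj-shuffle o {p} {r} {a ∷ σ′} σ≥1 p≤r r≤σ =
  ≡₂-trans (≡₂-reflexive unfold) (≡₂-trans termwise (≡₂-reflexive (bump-+ o 0 (imaj (a ∷ σ′)))))
  where
  τ : List ℕ
  τ = shuffle o p r (a ∷ σ′)
  unfold : imaj τ ≡ descent τ 0 + (descent τ 1 + sum (applyUpTo (descent τ ∘ suc ∘ suc) (length σ′)))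
  unfold = cong (λ n → sum (applyUpTo (descent τ) (n ∸ 1))) (length-shuffle o p r (a ∷ σ′))
  even : ∀ c → (if c then 2 else 0) ≡₂ 0
  even true = mod2 refl
  even false = ≡₂-refl
  termwise : descent τ 0 + (descent τ 1 + sum (applyUpTo (descent τ ∘ suc ∘ suc) (length σ′))) ≡₂ bump o 0 + (0 + imaj (a ∷ σ′))
  termwise = ≡₂-+ (≡₂-reflexive (descent-shuffle-0 o σ≥1 p≤r r≤σ))
    (≡₂-+ (even (idx 3 τ <ᵇ idx 2 τ)) (sum-applyUpTo-≡₂ (length σ′) (descent-shuffle-2+ o σ≥1 p≤r r≤σ)))

Placed-shuffle⁺ : ∀ o {G : Pred ℕ 0ℓ} {p r σ} → All (1 ≤_) σ → p ≤ r → r ≤ length σ →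
  G (suc r ∸ p) → Placed o G (shuffle o p r σ)
Placed-shuffle⁺ p12 {G} σ≥1 p≤r r≤σ g = subst₂ (λ a c → a < c × G (c ∸ a))
  (sym (idx-left p12 σ≥1 p≤r r≤σ)) (sym (idx-right p12 σ≥1 p≤r r≤σ)) (s≤s p≤r , g)
Placed-shuffle⁺ p21 {G} σ≥1 p≤r r≤σ g = subst₂ (λ a c → a < c × G (c ∸ a))
  (sym (idx-left p21 σ≥1 p≤r r≤σ)) (sym (idx-right p21 σ≥1 p≤r r≤σ)) (s≤s p≤r , g)

Placed-shuffle⁻ : ∀ π o {G : Pred ℕ 0ℓ} {p r σ} → All (1 ≤_) σ → p ≤ r → r ≤ length σ →
  Placed π G (shuffle o p r σ) → π ≡ o × G (suc r ∸ p)
Placed-shuffle⁻ p12 p12 {G} σ≥1 p≤r r≤σ (_ , g) =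
  refl , subst₂ (λ a c → G (c ∸ a)) (idx-left p12 σ≥1 p≤r r≤σ) (idx-right p12 σ≥1 p≤r r≤σ) g
Placed-shuffle⁻ p21 p21 {G} σ≥1 p≤r r≤σ (_ , g) =
  refl , subst₂ (λ a c → G (c ∸ a)) (idx-left p21 σ≥1 p≤r r≤σ) (idx-right p21 σ≥1 p≤r r≤σ) g
Placed-shuffle⁻ p12 p21 σ≥1 p≤r r≤σ (1<2 , _) = ⊥-elim (≤⇒≯ (m≤n⇒m≤1+n p≤r)
  (subst₂ _<_ (idx-right p21 σ≥1 p≤r r≤σ) (idx-left p21 σ≥1 p≤r r≤σ) 1<2))
Placed-shuffle⁻ p21 p12 σ≥1 p≤r r≤σ (2<1 , _) = ⊥-elim (≤⇒≯ (m≤n⇒m≤1+n p≤r)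
  (subst₂ _<_ (idx-right p12 σ≥1 p≤r r≤σ) (idx-left p12 σ≥1 p≤r r≤σ) 2<1))

Perm⇒positive : ∀ {m σ} → Perm m σ → All (1 ≤_) σ
Perm⇒positive (_ , bounds , _) = All.map proj₁ bounds

Perm⇒≤length : ∀ {m σ r} → Perm m σ → r ≤ m → r ≤ length σ
Perm⇒≤length (len , _) = subst (_ ≤_) (sym len)

B-congˡ : ∀ {m a a′} c → a ≡₂ a′ → B m a c ⊆ B m a′ c
B-congˡ c (mod2 a≡a′) (perm , inv≡ , imaj≡) = perm , trans inv≡ a≡a′ , imaj≡

B-shuffle⁺ : ∀ o {p r m σ i j} → p ≤ r → r ≤ m →
  B m (bump o i + (r + p)) (bump o j) σ → B (2 + m) i j (shuffle o p r σ)
B-shuffle⁺ o {p} {r} {m} {σ} {i} {j} p≤r r≤m (σ-perm , inv≡ , imaj≡) =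
  Perm-shuffle⁺ o p r σ-perm , %2-≡ inv-τ , %2-≡ imaj-τ
  where
  σ≥1 : All (1 ≤_) σ
  σ≥1 = Perm⇒positive σ-perm
  r≤σ : r ≤ length σ
  r≤σ = Perm⇒≤length σ-perm r≤m
  inv-τ : inv (shuffle o p r σ) ≡₂ i
  inv-τ = ≡₂-trans (≡₂-reflexive (inv-shuffle o σ≥1 p≤r r≤σ))
    (≡₂-sym (bump-≡₂ o (≡₂-sym (m≡₂k+n⇒m+n≡₂k (mod2 {inv σ} inv≡)))))
  imaj-τ : imaj (shuffle o p r σ) ≡₂ j
  imaj-τ = ≡₂-trans (imaj-shuffle o σ≥1 p≤r r≤σ) (≡₂-sym (bump-≡₂ o (≡₂-sym (mod2 imaj≡))))

B-shuffle⁻ : ∀ o {p r m σ i j} → All (1 ≤_) σ → p ≤ r → r ≤ m →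
  B (2 + m) i j (shuffle o p r σ) → B m (bump o i + (r + p)) (bump o j) σ
B-shuffle⁻ o {p} {r} {m} {σ} {i} {j} σ≥1 p≤r r≤m (τ-perm , inv≡ , imaj≡) =
  σ-perm , %2-≡ inv-σ , %2-≡ imaj-σ
  where
  σ-perm : Perm m σ
  σ-perm = Perm-shuffle⁻ o p r σ≥1 τ-perm
  r≤σ : r ≤ length σ
  r≤σ = Perm⇒≤length σ-perm r≤m
  inv-σ : inv σ ≡₂ bump o i + (r + p)
  inv-σ = m+n≡₂k⇒m≡₂k+n (bump-≡₂ o (≡₂-trans (≡₂-sym (≡₂-reflexive (inv-shuffle o σ≥1 p≤r r≤σ)))
    (mod2 {inv (shuffle o p r σ)} inv≡)))
  imaj-σ : imaj σ ≡₂ bump o j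
  imaj-σ = bump-≡₂ o (≡₂-trans (≡₂-sym (imaj-shuffle o σ≥1 p≤r r≤σ)) (mod2 imaj≡))

-- Every permutation of [m + 2] is a shuffle

Perm-∈ : ∀ {n τ v} → Perm n τ → 1 ≤ v → v ≤ n → v ∈ τ
Perm-∈ {n} {τ} {suc v} (len , bounds , τ!) _ v<n = proj₂ (∈-filter⁻ (_∈? τ) {xs = applyUpTo suc n} v∈present)
  where
  -- Keeping from 1, …, n the values that occur in τ loses nothing: the result is as long as τ.
  present : List ℕ
  present = filter (_∈? τ) (applyUpTo suc n)
  in-range : ∀ {x} → x ∈ τ → x ∈ applyUpTo suc n
  in-range x∈τ with All.lookup bounds x∈τ
  ... | s≤s _ , x≤n = ∈-applyUpTo⁺ suc x≤n
  present≡ : present ≡ applyUpTo suc n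
  present≡ = filter-complete (_∈? τ) (trans
    (length-unique-≈ (Unique.filter⁺ (_∈? τ) (Unique.applyUpTo⁺₁ suc n (λ i<j _ → <⇒≢ i<j ∘ suc-injective))) τ!
      (proj₂ ∘ ∈-filter⁻ (_∈? τ) {xs = applyUpTo suc n}) (λ x∈τ → ∈-filter⁺ (_∈? τ) (in-range x∈τ) x∈τ))
    (trans len (sym (length-applyUpTo suc n))))
  v∈present : suc v ∈ present
  v∈present = subst (suc v ∈_) (sym present≡) (∈-applyUpTo⁺ suc v<n)

std-positive : ∀ τ → All (1 ≤_) (std τ)
std-positive τ = All-map⁺ (All.map (λ { (s≤s (s≤s (s≤s _))) → s≤s z≤n }) (all-filter (3 ≤?_) τ))

map-2+∘∸2 : ∀ {w} → All (3 ≤_) w → map (2 +_) (map (_∸ 2) w) ≡ w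
map-2+∘∸2 {w} w≥3 = trans (sym (map-∘ w)) (map-id-local (All.map (m+[n∸m]≡n ∘ <⇒≤) w≥3))

insAt-filter : ∀ {Q : Pred ℕ 0ℓ} (Q? : Decidable Q) {x w} → Unique w → x ∈ w → ¬ Q x → (∀ {y} → y ∈ w → y ≢ x → Q y) →
  ∃ λ k → k ≤ length (filter Q? w) × w ≡ insAt k x (filter Q? w)
insAt-filter Q? {x} {w} w! x∈w ¬qx others =
  idx x w , ≤-pred (subst (idx x w <_) (trans (cong length w≡) (length-insAt (idx x w) x (filter Q? w))) (idx<length x∈w)) , w≡
  where
  w≡ : w ≡ insAt (idx x w) x (filter Q? w)
  w≡ = insAt-idx Q? w! x∈w ¬qx others

≢1∧≢2⇒≥3 : ∀ {y} → 1 ≤ y → y ≢ 1 → y ≢ 2 → 3 ≤ y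
≢1∧≢2⇒≥3 {1} _ y≢1 _ = ⊥-elim (y≢1 refl)
≢1∧≢2⇒≥3 {2} _ _ y≢2 = ⊥-elim (y≢2 refl)
≢1∧≢2⇒≥3 {suc (suc (suc _))} _ _ _ = s≤s (s≤s (s≤s z≤n))

-- Remove 1 from τ, then 2 from what is left; the rest is std τ shifted up by 2.
extract-1-2 : ∀ {m τ} → Perm (2 + m) τ → ∃ λ i₁ → ∃ λ i₂ →
  i₁ ≤ suc (length (map (2 +_) (std τ))) × i₂ ≤ length (map (2 +_) (std τ)) × τ ≡ insAt i₁ 1 (insAt i₂ 2 (map (2 +_) (std τ)))
extract-1-2 {m} {τ} τ-perm@(_ , bounds , τ!)
  with insAt-filter (¬? ∘ (_≟ 1)) τ! (Perm-∈ τ-perm (s≤s z≤n) (s≤s z≤n)) (λ 1≢1 → 1≢1 refl) (λ _ y≢1 → y≢1)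
... | i₁ , i₁≤ , τ≡
  with insAt-filter (3 ≤?_) (Unique.filter⁺ _ τ!) (∈-filter⁺ _ (Perm-∈ τ-perm (s≤s z≤n) (s≤s (s≤s z≤n))) (λ ()))
         (λ { (s≤s (s≤s ())) })
         (λ y∈w₁ → let (y∈τ , y≢1) = ∈-filter⁻ _ y∈w₁ in ≢1∧≢2⇒≥3 (proj₁ (All.lookup bounds y∈τ)) y≢1)
... | i₂ , i₂≤ , w₁≡ =
  i₁ , i₂ , subst (λ w → i₁ ≤ suc (length w)) rest≡ (subst (i₁ ≤_) (trans (cong length w₁≡) (length-insAt i₂ 2 _)) i₁≤) ,
  subst (λ w → i₂ ≤ length w) rest≡ i₂≤ ,
  subst (λ w → τ ≡ insAt i₁ 1 (insAt i₂ 2 w)) rest≡ (trans τ≡ (cong (insAt i₁ 1) w₁≡))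
  where
  w₁ : List ℕ
  w₁ = filter (¬? ∘ (_≟ 1)) τ
  rest≡ : filter (3 ≤?_) w₁ ≡ map (2 +_) (std τ)
  rest≡ = sym (trans
    (cong (map (2 +_) ∘ map (_∸ 2)) (trans (cong (filter (3 ≤?_)) τ≡) (filter-insAt-reject (3 ≤?_) i₁ w₁ λ { (s≤s ()) })))
    (map-2+∘∸2 (all-filter (3 ≤?_) w₁)))

orient-1-2 : ∀ i₁ i₂ W → i₁ ≤ suc (length W) → i₂ ≤ length W → ∃ λ o → ∃ λ p → ∃ λ r →
  p ≤ r × r ≤ length W × insAt i₁ 1 (insAt i₂ 2 W) ≡ insAt p (leftValue o) (insAt r (rightValue o) W)
orient-1-2 i₁ i₂ W i₁≤ i₂≤ with i₂ <? i₁
... | no i₂≮i₁ = p12 , i₁ , i₂ , ≮⇒≥ i₂≮i₁ , i₂≤ , refl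
orient-1-2 (suc i₁) i₂ W i₁≤ i₂≤ | yes i₂<i₁ =
  p21 , i₂ , i₁ , ≤-pred i₂<i₁ , ≤-pred i₁≤ , insAt-comm i₁ i₂ 1 2 W (≤-pred i₂<i₁) (≤-pred i₁≤)

record ShuffleForm (m : ℕ) (τ : List ℕ) : Set where
  field
    pat : Pat
    p r : ℕ
    p≤r : p ≤ r
    r≤m : r ≤ m
    std-perm : Perm m (std τ)
    τ≡shuffle : τ ≡ shuffle pat p r (std τ)

decompose : ∀ m {τ} → Perm (2 + m) τ → ShuffleForm m τ
decompose m {τ} τ-perm with extract-1-2 τ-perm
... | i₁ , i₂ , i₁≤ , i₂≤ , τ≡ with orient-1-2 i₁ i₂ (map (2 +_) (std τ)) i₁≤ i₂≤
... | o , p , r , p≤r , r≤W , ≡shuffle = record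
  { pat = o ; p = p ; r = r ; p≤r = p≤r
  ; r≤m = subst (r ≤_) (trans (length-map (2 +_) (std τ)) (proj₁ σ-perm)) r≤W
  ; std-perm = σ-perm ; τ≡shuffle = trans τ≡ ≡shuffle }
  where
  σ-perm : Perm m (std τ)
  σ-perm = Perm-shuffle⁻ o p r (std-positive τ) (subst (Perm (2 + m)) (trans τ≡ ≡shuffle) τ-perm)

-- The four components of B (m + 2) i j

Shuffle-shuffle⁺ : ∀ o (G : Pred ℕ 0ℓ) (N : Pred (List ℕ) 0ℓ) {m p r σ} → p ≤ r → r ≤ m → Perm m σ →
  G (suc r ∸ p) → N σ → Shuffle (2 + m) o G N (shuffle o p r σ)
Shuffle-shuffle⁺ o G N {p = p} {r} p≤r r≤m σ-perm g nσ =
  Perm-shuffle⁺ o p r σ-perm ,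
  Placed-shuffle⁺ o (Perm⇒positive σ-perm) p≤r (Perm⇒≤length σ-perm r≤m) g ,
  subst N (sym (std-shuffle o p r (Perm⇒positive σ-perm))) nσ

Shuffle-shuffle⁻ : ∀ π o (G : Pred ℕ 0ℓ) (N : Pred (List ℕ) 0ℓ) {m p r σ} → p ≤ r → r ≤ m → Perm m σ →
  Shuffle (2 + m) π G N (shuffle o p r σ) → π ≡ o × G (suc r ∸ p) × N σ
Shuffle-shuffle⁻ π o G N {p = p} {r} p≤r r≤m σ-perm (_ , placed , nσ) =
  let (π≡o , g) = Placed-shuffle⁻ π o (Perm⇒positive σ-perm) p≤r (Perm⇒≤length σ-perm r≤m) placed
  in π≡o , g , subst N (std-shuffle o p r (Perm⇒positive σ-perm)) nσ

Shuffle-disjoint-pattern : ∀ {n} G G′ N N′ → Shuffle n p12 G N ⊥ Shuffle n p21 G′ N′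
Shuffle-disjoint-pattern _ _ _ _ ((_ , (1<2 , _) , _) , (_ , (2<1 , _) , _)) = <-asym 1<2 2<1

Shuffle-disjoint-gap : ∀ {n} π N N′ → Shuffle n π O N ⊥ Shuffle n π E N′
Shuffle-disjoint-gap p12 _ _ ((_ , (_ , odd) , _) , (_ , (_ , even) , _)) = O⇒¬E odd even
Shuffle-disjoint-gap p21 _ _ ((_ , (_ , odd) , _) , (_ , (_ , even) , _)) = O⇒¬E odd even

module Components (m i j : ℕ) where

  C₁ C₂ C₃ C₄ Components : Pred (List ℕ) 0ℓ
  C₁ = Shuffle (2 + m) p12 O (B m i j)
  C₂ = Shuffle (2 + m) p12 E (B m (suc i) j)
  C₃ = Shuffle (2 + m) p21 E (B m i (suc j))
  C₄ = Shuffle (2 + m) p21 O (B m (suc i) (suc j))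
  Components = C₁ ∪ C₂ ∪ C₃ ∪ C₄

  Components-disjoint : (C₁ ⊥ C₂) × (C₁ ⊥ C₃) × (C₁ ⊥ C₄) × (C₂ ⊥ C₃) × (C₂ ⊥ C₄) × (C₃ ⊥ C₄)
  Components-disjoint =
    Shuffle-disjoint-gap p12 (B m i j) (B m (suc i) j) ,
    Shuffle-disjoint-pattern O E (B m i j) (B m i (suc j)) ,
    Shuffle-disjoint-pattern O O (B m i j) (B m (suc i) (suc j)) ,
    Shuffle-disjoint-pattern E E (B m (suc i) j) (B m i (suc j)) ,
    Shuffle-disjoint-pattern E O (B m (suc i) j) (B m (suc i) (suc j)) ,
    ⊥-sym {x = C₄} {y = C₃} (Shuffle-disjoint-gap p21 (B m (suc i) (suc j)) (B m i (suc j)))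

  shuffle∈Components : ∀ o {p r σ} → p ≤ r → r ≤ m → Perm m σ →
    B m (bump o i + (r + p)) (bump o j) σ → Components (shuffle o p r σ)
  shuffle∈Components p12 p≤r r≤m σ-perm σ∈B with O⊎E (gap-positive p≤r)
  ... | inj₁ odd = inj₁ (Shuffle-shuffle⁺ p12 O (B m i j) p≤r r≤m σ-perm odd (B-congˡ j (odd-gap i p≤r odd) σ∈B))
  ... | inj₂ even = inj₂ (inj₁ (Shuffle-shuffle⁺ p12 E (B m (suc i) j) p≤r r≤m σ-perm even (B-congˡ j (even-gap i p≤r even) σ∈B)))
  shuffle∈Components p21 p≤r r≤m σ-perm σ∈B with O⊎E (gap-positive p≤r)
  ... | inj₁ odd = inj₂ (inj₂ (inj₂ (Shuffle-shuffle⁺ p21 O (B m (suc i) (suc j)) p≤r r≤m σ-perm odd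
          (B-congˡ (suc j) (odd-gap (suc i) p≤r odd) σ∈B))))
  ... | inj₂ even = inj₂ (inj₂ (inj₁ (Shuffle-shuffle⁺ p21 E (B m i (suc j)) p≤r r≤m σ-perm even
          (B-congˡ (suc j) (≡₂-trans (even-gap (suc i) p≤r even) (2+m≡₂m i)) σ∈B))))

  Components∋shuffle : ∀ o {p r σ} → p ≤ r → r ≤ m → Perm m σ →
    Components (shuffle o p r σ) → B m (bump o i + (r + p)) (bump o j) σ
  Components∋shuffle o p≤r r≤m σ-perm (inj₁ c) with Shuffle-shuffle⁻ p12 o O (B m i j) p≤r r≤m σ-perm c
  ... | refl , odd , σ∈B = B-congˡ j (≡₂-sym (odd-gap i p≤r odd)) σ∈B
  Components∋shuffle o p≤r r≤m σ-perm (inj₂ (inj₁ c)) with Shuffle-shuffle⁻ p12 o E (B m (suc i) j) p≤r r≤m σ-perm c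
  ... | refl , even , σ∈B = B-congˡ j (≡₂-sym (even-gap i p≤r even)) σ∈B
  Components∋shuffle o p≤r r≤m σ-perm (inj₂ (inj₂ (inj₁ c))) with Shuffle-shuffle⁻ p21 o E (B m i (suc j)) p≤r r≤m σ-perm c
  ... | refl , even , σ∈B = B-congˡ (suc j) (≡₂-sym (≡₂-trans (even-gap (suc i) p≤r even) (2+m≡₂m i))) σ∈B
  Components∋shuffle o p≤r r≤m σ-perm (inj₂ (inj₂ (inj₂ c))) with Shuffle-shuffle⁻ p21 o O (B m (suc i) (suc j)) p≤r r≤m σ-perm c
  ... | refl , odd , σ∈B = B-congˡ (suc j) (≡₂-sym (odd-gap (suc i) p≤r odd)) σ∈B

  Components⇒Perm : Components ⊆ Perm (2 + m)
  Components⇒Perm (inj₁ (τ-perm , _)) = τ-perm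
  Components⇒Perm (inj₂ (inj₁ (τ-perm , _))) = τ-perm
  Components⇒Perm (inj₂ (inj₂ (inj₁ (τ-perm , _)))) = τ-perm
  Components⇒Perm (inj₂ (inj₂ (inj₂ (τ-perm , _)))) = τ-perm

  B≐Components : B (2 + m) i j ≐ Components
  B≐Components = B⊆Components , Components⊆B
    where
    B⊆Components : B (2 + m) i j ⊆ Components
    B⊆Components {τ} τ∈B = subst Components (sym τ≡shuffle)
      (shuffle∈Components pat p≤r r≤m std-perm
        (B-shuffle⁻ pat (Perm⇒positive std-perm) p≤r r≤m (subst (B (2 + m) i j) τ≡shuffle τ∈B)))
      where open ShuffleForm (decompose m (proj₁ τ∈B))
    Components⊆B : Components ⊆ B (2 + m) i j
    Components⊆B {τ} τ∈C = subst (B (2 + m) i j) (sym τ≡shuffle)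
      (B-shuffle⁺ pat p≤r r≤m (Components∋shuffle pat p≤r r≤m std-perm (subst Components τ≡shuffle τ∈C)))
      where open ShuffleForm (decompose m (Components⇒Perm τ∈C))

∈-words⁻ : ∀ k m {w} → w ∈ words k m → length w ≡ m × All (λ a → 1 ≤ a × a ≤ k) w
∈-words⁻ k zero (here refl) = refl , []
∈-words⁻ k (suc m) w∈ with find (∈-concatMap⁻ (λ a → map (a ∷_) (words k m)) {xs = applyUpTo suc k} w∈)
... | a , a∈ , w∈′ with ∈-map⁻ (a ∷_) w∈′ | ∈-applyUpTo⁻ suc a∈
... | w′ , w′∈ , refl | _ , a<k , refl = let (len , bounds) = ∈-words⁻ k m w′∈ in cong suc len , (s≤s z≤n , a<k) ∷ bounds

∈-words⁺ : ∀ k m {w} → length w ≡ m → All (λ a → 1 ≤ a × a ≤ k) w → w ∈ words k m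
∈-words⁺ k zero {[]} _ _ = here refl
∈-words⁺ k (suc m) {suc a ∷ w} len ((_ , a<k) ∷ bounds) =
  ∈-concatMap⁺ (λ a → map (a ∷_) (words k m))
    (lose (∈-applyUpTo⁺ suc a<k) (∈-map⁺ (suc a ∷_) (∈-words⁺ k m (suc-injective len) bounds)))

words-unique : ∀ k m → Unique (words k m)
words-unique k zero = [] ∷ []
words-unique k (suc m) = Unique-concatMap (λ a → map (a ∷_) (words k m)) first
  (Unique.applyUpTo⁺₁ suc k (λ i<j _ → <⇒≢ i<j ∘ suc-injective))
  (λ _ → Unique.map⁺ (λ { refl → refl }) (words-unique k m))
  (λ {a} _ w∈ → let (_ , _ , w≡) = ∈-map⁻ (a ∷_) w∈ in cong first w≡)
  where
  first : List ℕ → ℕ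
  first [] = 0
  first (a ∷ _) = a

Perm⇒∈words : ∀ {m σ} → Perm m σ → σ ∈ words m m
Perm⇒∈words (len , bounds , _) = ∈-words⁺ _ _ len bounds

∈words⇒positive : ∀ m {σ} → σ ∈ words m m → All (1 ≤_) σ
∈words⇒positive m σ∈ = All.map proj₁ (proj₂ (∈-words⁻ m m σ∈))

shufflesAt : ℕ → ℕ → ℕ → List (List ℕ)
shufflesAt m r p = map (shuffle p12 p r) (words m m) ++ map (shuffle p21 p r) (words m m)

shuffles : ℕ → List (List ℕ)
shuffles m = concatMap (λ r → concatMap (shufflesAt m r) (downFrom (suc r))) (downFrom (suc m))

positions-shuffle : ∀ o {p r σ} → All (1 ≤_) σ → p ≤ r → r ≤ length σ →
  (idx 1 (shuffle o p r σ) ⊓ idx 2 (shuffle o p r σ) ≡ p) × (idx 1 (shuffle o p r σ) ⊔ idx 2 (shuffle o p r σ) ≡ suc r)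
positions-shuffle p12 σ≥1 p≤r r≤σ rewrite idx-left p12 σ≥1 p≤r r≤σ | idx-right p12 σ≥1 p≤r r≤σ =
  m≤n⇒m⊓n≡m (m≤n⇒m≤1+n p≤r) , m≤n⇒m⊔n≡n (m≤n⇒m≤1+n p≤r)
positions-shuffle p21 σ≥1 p≤r r≤σ rewrite idx-left p21 σ≥1 p≤r r≤σ | idx-right p21 σ≥1 p≤r r≤σ =
  m≥n⇒m⊓n≡n (m≤n⇒m≤1+n p≤r) , m≥n⇒m⊔n≡m (m≤n⇒m≤1+n p≤r)

module _ (m : ℕ) where

  private
    shuffleAt-∈ : ∀ {r p τ} → τ ∈ shufflesAt m r p → ∃ λ o → ∃ λ σ → σ ∈ words m m × τ ≡ shuffle o p r σ
    shuffleAt-∈ {r} {p} τ∈ with ∈-++⁻ (map (shuffle p12 p r) (words m m)) τ∈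
    ... | inj₁ τ∈₁ = let (σ , σ∈ , τ≡) = ∈-map⁻ (shuffle p12 p r) τ∈₁ in p12 , σ , σ∈ , τ≡
    ... | inj₂ τ∈₂ = let (σ , σ∈ , τ≡) = ∈-map⁻ (shuffle p21 p r) τ∈₂ in p21 , σ , σ∈ , τ≡

    positions : ∀ {r p τ} → p ≤ r → r ≤ m → τ ∈ shufflesAt m r p →
      (idx 1 τ ⊓ idx 2 τ ≡ p) × (idx 1 τ ⊔ idx 2 τ ≡ suc r)
    positions p≤r r≤m τ∈ with shuffleAt-∈ τ∈
    ... | o , σ , σ∈ , refl =
      positions-shuffle o (∈words⇒positive m σ∈) p≤r (subst (_ ≤_) (sym (proj₁ (∈-words⁻ m m σ∈))) r≤m)

    shufflesAt-unique : ∀ {r p} → p ≤ r → r ≤ m → Unique (shufflesAt m r p)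
    shufflesAt-unique {r} {p} p≤r r≤m = Unique.++⁺ (shuffles-unique p12) (shuffles-unique p21) disjoint
      where
      shuffles-unique : ∀ o → Unique (map (shuffle o p r) (words m m))
      shuffles-unique o = Unique-map-leftInverse (shuffle o p r) std
        (std-shuffle o p r ∘ ∈words⇒positive m) (words-unique m m)
      -- 1 is at position p in the first list and at position r + 1 in the second.
      disjoint : ∀ {τ} → ¬ (τ ∈ map (shuffle p12 p r) (words m m) × τ ∈ map (shuffle p21 p r) (words m m))
      disjoint (τ∈₁ , τ∈₂) with ∈-map⁻ (shuffle p12 p r) τ∈₁ | ∈-map⁻ (shuffle p21 p r) τ∈₂
      ... | σ₁ , σ₁∈ , refl | σ₂ , σ₂∈ , τ≡ = <⇒≢ (s≤s p≤r)
        (trans (sym (idx-left p12 (∈words⇒positive m σ₁∈) p≤r (r≤ σ₁∈)))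
          (trans (cong (idx 1) τ≡) (idx-right p21 (∈words⇒positive m σ₂∈) p≤r (r≤ σ₂∈))))
        where
        r≤ : ∀ {σ} → σ ∈ words m m → r ≤ length σ
        r≤ σ∈ = subst (r ≤_) (sym (proj₁ (∈-words⁻ m m σ∈))) r≤m

  shuffles-unique : Unique (shuffles m)
  shuffles-unique = Unique-concatMap (λ r → concatMap (shufflesAt m r) (downFrom (suc r))) (pred ∘ λ τ → idx 1 τ ⊔ idx 2 τ)
    (Unique.downFrom⁺ (suc m))
    (λ r∈ → Unique-concatMap (shufflesAt m _) (λ τ → idx 1 τ ⊓ idx 2 τ) (Unique.downFrom⁺ _)
      (λ p∈ → shufflesAt-unique (≤-pred (∈-downFrom⁻ p∈)) (≤-pred (∈-downFrom⁻ r∈)))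
      (λ p∈ τ∈ → proj₁ (positions (≤-pred (∈-downFrom⁻ p∈)) (≤-pred (∈-downFrom⁻ r∈)) τ∈)))
    (λ {r} r∈ τ∈ → let (p , p∈ , τ∈′) = find (∈-concatMap⁻ (shufflesAt m r) {xs = downFrom (suc r)} τ∈)
      in cong pred (proj₂ (positions (≤-pred (∈-downFrom⁻ p∈)) (≤-pred (∈-downFrom⁻ r∈)) τ∈′)))

  Perm⇒∈shuffles : ∀ {τ} → Perm (2 + m) τ → τ ∈ shuffles m
  Perm⇒∈shuffles {τ} τ-perm = subst (_∈ shuffles m) (sym τ≡shuffle)
    (∈-concatMap⁺ (λ r → concatMap (shufflesAt m r) (downFrom (suc r))) (lose (∈-downFrom⁺ (s≤s r≤m))
      (∈-concatMap⁺ (shufflesAt m r) (lose (∈-downFrom⁺ (s≤s p≤r)) (in-shufflesAt pat)))))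
    where
    open ShuffleForm (decompose m τ-perm)
    in-shufflesAt : ∀ o → shuffle o p r (std τ) ∈ shufflesAt m r p
    in-shufflesAt p12 = ∈-++⁺ˡ (∈-map⁺ (shuffle p12 p r) (Perm⇒∈words std-perm))
    in-shufflesAt p21 = ∈-++⁺ʳ (map (shuffle p12 p r) (words m m)) (∈-map⁺ (shuffle p21 p r) (Perm⇒∈words std-perm))

pairCount : ℕ → ℕ → ℕ → ℕ → ℕ
pairCount m i j s = b m (i + s) j + b m (suc i + s) (suc j)

count-shuffles : ∀ o {m p r} i j → p ≤ r → r ≤ m →
  length (filter (B? (2 + m) i j) (map (shuffle o p r) (words m m))) ≡ b m (bump o i + (r + p)) (bump o j)
count-shuffles o {m} {p} {r} i j p≤r r≤m =
  trans (length-filter-map (B? (2 + m) i j) (shuffle o p r) (words m m))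
    (length-filter-cong-local _ (B? m (bump o i + (r + p)) (bump o j)) (words m m)
      (λ σ∈ → B-shuffle⁻ o (∈words⇒positive m σ∈) p≤r r≤m) (λ _ → B-shuffle⁺ o p≤r r≤m))

b-recurrence : ∀ m i j → b (2 + m) i j ≡ pairSum (pairCount m i j) m
b-recurrence m i j = begin
  b (2 + m) i j
    ≡⟨ length-filter-unique P? (words-unique (2 + m) (2 + m)) (shuffles-unique m)
         (λ τ∈B _ → Perm⇒∈shuffles m (proj₁ τ∈B)) (λ τ∈B _ → Perm⇒∈words (proj₁ τ∈B)) ⟩
  length (filter P? (shuffles m))
    ≡⟨ length-filter-concatMap P? (λ r → concatMap (shufflesAt m r) (downFrom (suc r))) (downFrom (suc m)) ⟩
  sum (map (λ r → length (filter P? (concatMap (shufflesAt m r) (downFrom (suc r))))) (downFrom (suc m)))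
    ≡⟨ sum-map-cong-local (downFrom (suc m)) (λ {r} r∈ → trans (length-filter-concatMap P? (shufflesAt m r) (downFrom (suc r)))
         (sum-map-cong-local (downFrom (suc r)) (λ p∈ → count-shufflesAt (≤-pred (∈-downFrom⁻ p∈)) (≤-pred (∈-downFrom⁻ r∈))))) ⟩
  pairSum (pairCount m i j) m  ∎
  where
  P? : Decidable (B (2 + m) i j)
  P? = B? (2 + m) i j
  count-shufflesAt : ∀ {r p} → p ≤ r → r ≤ m → length (filter P? (shufflesAt m r p)) ≡ pairCount m i j (r + p)
  count-shufflesAt {r} {p} p≤r r≤m = trans (length-filter-++ P? (map (shuffle p12 p r) (words m m)) _)
    (cong₂ _+_ (count-shuffles p12 i j p≤r r≤m) (count-shuffles p21 i j p≤r r≤m))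

-- Recurrences for b

b-cong : ∀ N {a a′ c c′} → a ≡₂ a′ → c ≡₂ c′ → b N a c ≡ b N a′ c′
b-cong N (mod2 a≡a′) (mod2 c≡c′) =
  cong₂ (λ x y → length (filter (λ w → Perm? N w ×-dec ((inv w % 2 ≟ x) ×-dec (imaj w % 2 ≟ y))) (words N N))) a≡a′ c≡c′

pairCount-periodic : ∀ m i j s → pairCount m i j (2 + s) ≡ pairCount m i j s
pairCount-periodic m i j s = cong₂ _+_ (b-cong m (shift i) (≡₂-refl {j})) (b-cong m (shift (suc i)) (≡₂-refl {suc j}))
  where
  shift : ∀ i → i + suc (suc s) ≡₂ i + s
  shift i = ≡₂-trans (≡₂-reflexive (trans (+-suc i (suc s)) (cong suc (+-suc i s)))) (2+m≡₂m (i + s))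

b-suc-suc : ∀ m i j → b (2 + m) i j ≡ b (2 + m) (suc i) (suc j)
b-suc-suc m i j = begin
  b (2 + m) i j                                 ≡⟨ b-recurrence m i j ⟩
  pairSum (pairCount m i j) m                   ≡⟨ pairSum-cong m swap ⟩
  pairSum (pairCount m (suc i) (suc j)) m       ≡⟨ b-recurrence m (suc i) (suc j) ⟨
  b (2 + m) (suc i) (suc j)                     ∎
  where
  -- Shifting (i, j) by (1, 1) turns the first summand of pairCount into the second and the second,
  -- up to parity, into the first.
  swap : ∀ s → pairCount m i j s ≡ pairCount m (suc i) (suc j) s
  swap s = trans (+-comm (b m (i + s) j) _)
    (cong (b m (suc i + s) (suc j) +_) (b-cong m (≡₂-sym (2+m≡₂m (i + s))) (≡₂-sym (2+m≡₂m j))))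

bPair : ℕ → ℕ → ℕ → ℕ
bPair N i j = b N i j + b N (suc i) (suc j)

bPair-2+ : ∀ m i j → bPair (2 + m) i j ≡ 2 * b (2 + m) i j
bPair-2+ m i j = cong (b (2 + m) i j +_) (trans (sym (b-suc-suc m i j)) (sym (+-identityʳ _)))

pairCount-0 : ∀ m i j → pairCount m i j 0 ≡ bPair m i j
pairCount-0 m i j = cong₂ (λ x y → b m x j + b m y (suc j)) (+-identityʳ i) (+-identityʳ (suc i))

pairCount-1 : ∀ m i j → pairCount m i j 1 ≡ bPair m (suc i) j
pairCount-1 m i j = cong₂ (λ x y → b m x j + b m y (suc j)) (+-comm i 1) (+-comm (suc i) 1)

b-double≡bPair-sum : ∀ k i j → b (double (suc k)) i j ≡ (suc k * suc k) * bPair (double k) i j + (suc k * k) * bPair (double k) (suc i) j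
b-double≡bPair-sum k i j = trans (b-recurrence (double k) i j)
  (trans (pairSum-double (pairCount (double k) i j) (pairCount-periodic (double k) i j) k)
    (cong₂ (λ x y → (suc k * suc k) * x + (suc k * k) * y) (pairCount-0 (double k) i j) (pairCount-1 (double k) i j)))

b-double+1≡bPair-sum : ∀ k i j → b (suc (double (suc k))) i j ≡
  (suc k * suc (suc k)) * bPair (suc (double k)) i j + (suc k * suc k) * bPair (suc (double k)) (suc i) j
b-double+1≡bPair-sum k i j = trans (b-recurrence (suc (double k)) i j)
  (trans (pairSum-double+1 (pairCount (suc (double k)) i j) (pairCount-periodic (suc (double k)) i j) k)
    (cong₂ (λ x y → (suc k * suc (suc k)) * x + (suc k * suc k) * y) (pairCount-0 (suc (double k)) i j) (pairCount-1 (suc (double k)) i j)))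

b-double-recurrence : ∀ k i j → b (double (suc (suc k))) i j ≡
  2 * suc (suc k) * suc (suc k) * b (double (suc k)) i j + 2 * suc (suc k) * suc k * b (double (suc k)) (suc i) j
b-double-recurrence k i j = begin
  b (double (suc (suc k))) i j
    ≡⟨ b-double≡bPair-sum (suc k) i j ⟩
  suc (suc k) * suc (suc k) * bPair (double (suc k)) i j + suc (suc k) * suc k * bPair (double (suc k)) (suc i) j
    ≡⟨ cong₂ (λ x y → suc (suc k) * suc (suc k) * x + suc (suc k) * suc k * y) (bPair-2+ (double k) i j) (bPair-2+ (double k) (suc i) j) ⟩
  suc (suc k) * suc (suc k) * (2 * x) + suc (suc k) * suc k * (2 * y)
    ≡⟨ arith k x y ⟩
  2 * suc (suc k) * suc (suc k) * x + 2 * suc (suc k) * suc k * y  ∎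
  where
  x y : ℕ
  x = b (double (suc k)) i j
  y = b (double (suc k)) (suc i) j
  arith : ∀ k x y → suc (suc k) * suc (suc k) * (2 * x) + suc (suc k) * suc k * (2 * y)
                  ≡ 2 * suc (suc k) * suc (suc k) * x + 2 * suc (suc k) * suc k * y
  arith = solve-∀

b-double+1-recurrence : ∀ k i j → b (suc (double (suc (suc k)))) i j ≡
  2 * suc (suc k) * (suc (suc k) + 1) * b (suc (double (suc k))) i j + 2 * suc (suc k) * suc (suc k) * b (suc (double (suc k))) (suc i) j
b-double+1-recurrence k i j = begin
  b (suc (double (suc (suc k)))) i j
    ≡⟨ b-double+1≡bPair-sum (suc k) i j ⟩
  suc (suc k) * suc (suc (suc k)) * bPair (suc (double (suc k))) i j + suc (suc k) * suc (suc k) * bPair (suc (double (suc k))) (suc i) j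
    ≡⟨ cong₂ (λ x y → suc (suc k) * suc (suc (suc k)) * x + suc (suc k) * suc (suc k) * y)
         (bPair-2+ (suc (double k)) i j) (bPair-2+ (suc (double k)) (suc i) j) ⟩
  suc (suc k) * suc (suc (suc k)) * (2 * x) + suc (suc k) * suc (suc k) * (2 * y)
    ≡⟨ arith k x y ⟩
  2 * suc (suc k) * (suc (suc k) + 1) * x + 2 * suc (suc k) * suc (suc k) * y  ∎
  where
  x y : ℕ
  x = b (suc (double (suc k))) i j
  y = b (suc (double (suc k))) (suc i) j
  arith : ∀ k x y → suc (suc k) * suc (suc (suc k)) * (2 * x) + suc (suc k) * suc (suc k) * (2 * y)
                  ≡ 2 * suc (suc k) * (suc (suc k) + 1) * x + 2 * suc (suc k) * suc (suc k) * y
  arith = solve-∀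

b-even-recurrence : ∀ n → 2 ≤ n → ∀ i j →
  b (2 * n) i j ≡ 2 * n * n * b (2 * n ∸ 2) i j + 2 * n * (n ∸ 1) * b (2 * n ∸ 2) (suc i) j
b-even-recurrence (suc zero) (s≤s ())
b-even-recurrence n@(suc (suc k)) _ i j =
  subst (λ N → b N i j ≡ 2 * n * n * b (N ∸ 2) i j + 2 * n * suc k * b (N ∸ 2) (suc i) j) (sym (2*n≡double n)) (b-double-recurrence k i j)

b-odd-recurrence : ∀ n → 2 ≤ n → ∀ i j →
  b (2 * n + 1) i j ≡ 2 * n * (n + 1) * b (2 * n ∸ 1) i j + 2 * n * n * b (2 * n ∸ 1) (suc i) j
b-odd-recurrence (suc zero) (s≤s ())
b-odd-recurrence n@(suc (suc k)) _ i j =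
  subst₂ (λ A N → b A i j ≡ 2 * n * (n + 1) * b N i j + 2 * n * n * b N (suc i) j)
    (sym (trans (cong (_+ 1) (2*n≡double n)) (+-comm (double n) 1))) (sym (cong (_∸ 1) (2*n≡double n))) (b-double+1-recurrence k i j)

bPair-mod2 : ∀ N i j → bPair N i j ≡ bPair N (i % 2) (j % 2)
bPair-mod2 N i j = cong₂ _+_ (b-cong N (≡₂-sym (m%2≡₂m i)) (≡₂-sym (m%2≡₂m j)))
  (b-cong N (≡₂-suc (≡₂-sym (m%2≡₂m i))) (≡₂-suc (≡₂-sym (m%2≡₂m j))))

bPair-2≡2*bPair-1 : ∀ i j → bPair 2 i j ≡ 2 * 1 * bPair 1 i j
bPair-2≡2*bPair-1 i j = trans (bPair-mod2 2 i j)
  (trans (by-parity (i % 2) (j % 2) (m%n<n i 2) (m%n<n j 2)) (cong (2 * 1 *_) (sym (bPair-mod2 1 i j))))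
  where
  by-parity : ∀ a c → a < 2 → c < 2 → bPair 2 a c ≡ 2 * 1 * bPair 1 a c
  by-parity 0 0 _ _ = refl
  by-parity 0 1 _ _ = refl
  by-parity 1 0 _ _ = refl
  by-parity 1 1 _ _ = refl
  by-parity (suc (suc _)) _ (s≤s (s≤s ())) _
  by-parity _ (suc (suc _)) _ (s≤s (s≤s ()))

b-even≡2n*b-odd-step : ∀ k → (∀ i j → bPair (double (suc k)) i j ≡ 2 * suc k * bPair (suc (double k)) i j) →
  ∀ i j → b (double (suc (suc k))) i j ≡ 2 * suc (suc k) * b (suc (double (suc k))) i j
b-even≡2n*b-odd-step k bPair≡ i j = begin
  b (double (suc (suc k))) i j
    ≡⟨ b-double≡bPair-sum (suc k) i j ⟩
  suc (suc k) * suc (suc k) * bPair (double (suc k)) i j + suc (suc k) * suc k * bPair (double (suc k)) (suc i) j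
    ≡⟨ cong₂ (λ u v → suc (suc k) * suc (suc k) * u + suc (suc k) * suc k * v) (bPair≡ i j) (bPair≡ (suc i) j) ⟩
  suc (suc k) * suc (suc k) * (2 * suc k * x) + suc (suc k) * suc k * (2 * suc k * y)
    ≡⟨ arith k x y ⟩
  2 * suc (suc k) * (suc k * suc (suc k) * x + suc k * suc k * y)
    ≡⟨ cong (2 * suc (suc k) *_) (b-double+1≡bPair-sum k i j) ⟨
  2 * suc (suc k) * b (suc (double (suc k))) i j  ∎
  where
  x y : ℕ
  x = bPair (suc (double k)) i j
  y = bPair (suc (double k)) (suc i) j
  arith : ∀ k x y → suc (suc k) * suc (suc k) * (2 * suc k * x) + suc (suc k) * suc k * (2 * suc k * y)
                  ≡ 2 * suc (suc k) * (suc k * suc (suc k) * x + suc k * suc k * y)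
  arith = solve-∀

-- The induction runs on bPair because the base case fails for b itself: b 2 0 0 = b 1 0 0 = 1.
bPair-even≡2n*bPair-odd : ∀ k i j → bPair (double (suc k)) i j ≡ 2 * suc k * bPair (suc (double k)) i j
bPair-even≡2n*bPair-odd zero = bPair-2≡2*bPair-1
bPair-even≡2n*bPair-odd (suc k) i j = trans (cong₂ _+_ (b-double≡ i j) (b-double≡ (suc i) (suc j)))
  (sym (*-distribˡ-+ (2 * suc (suc k)) (b (suc (double (suc k))) i j) (b (suc (double (suc k))) (suc i) (suc j))))
  where
  b-double≡ : ∀ i j → b (double (suc (suc k))) i j ≡ 2 * suc (suc k) * b (suc (double (suc k))) i j
  b-double≡ = b-even≡2n*b-odd-step k (bPair-even≡2n*bPair-odd k)

b-even≡2n*b-odd : ∀ n → 2 ≤ n → ∀ i j → b (2 * n) i j ≡ 2 * n * b (2 * n ∸ 1) i j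
b-even≡2n*b-odd (suc zero) (s≤s ())
b-even≡2n*b-odd n@(suc (suc k)) _ i j =
  subst₂ (λ A N → b A i j ≡ 2 * n * b N i j) (sym (2*n≡double n)) (sym (cong (_∸ 1) (2*n≡double n)))
    (b-even≡2n*b-odd-step k (bPair-even≡2n*bPair-odd k) i j)

-- Integrality of b / (2 ^ (n ∸ 1) * n !)

nrm≢0 : ∀ m → NonZero (nrm m)
nrm≢0 m = m*n≢0 (2 ^ (m ∸ 1)) (m !) {{m^n≢0 2 (m ∸ 1)}} {{m !≢0}}

linear-quotient : ∀ {d D} .{{_ : NonZero d}} .{{_ : NonZero D}} e c₁ c₂ {x y z} → D ≡ e * d → d ∣ x → d ∣ y →
  z ≡ e * c₁ * x + e * c₂ * y → (D ∣ z) × (z / D ≡ c₁ * (x / d) + c₂ * (y / d))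
linear-quotient {d} {D} e c₁ c₂ {x} {y} {z} D≡ed d∣x d∣y z≡ = divides q z≡qD , trans (cong (_/ D) z≡qD) (m*n/n≡m q D)
  where
  q : ℕ
  q = c₁ * (x / d) + c₂ * (y / d)
  z≡qD : z ≡ q * D
  z≡qD = begin
    z                                            ≡⟨ z≡ ⟩
    e * c₁ * x + e * c₂ * y                      ≡⟨ cong₂ (λ u v → e * c₁ * u + e * c₂ * v) (m/n*n≡m d∣x) (m/n*n≡m d∣y) ⟨
    e * c₁ * (x / d * d) + e * c₂ * (y / d * d)  ≡⟨ arith e c₁ c₂ (x / d) (y / d) d ⟩
    q * (e * d)                                  ≡⟨ cong (q *_) D≡ed ⟨
    q * D                                        ∎
    where
    arith : ∀ e c₁ c₂ q₁ q₂ d → e * c₁ * (q₁ * d) + e * c₂ * (q₂ * d) ≡ (c₁ * q₁ + c₂ * q₂) * (e * d)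
    arith = solve-∀

nrm-step : ∀ n → 2 ≤ n → nrm n ≡ 2 * n * nrm (n ∸ 1)
nrm-step (suc zero) (s≤s ())
nrm-step (suc (suc k)) _ = arith (2 ^ k) (suc k !) k
  where
  arith : ∀ p f k → 2 * p * (suc (suc k) * f) ≡ 2 * suc (suc k) * (p * f)
  arith = solve-∀

2*n∸1≡1+2*[n∸1] : ∀ n → 1 ≤ n → 2 * n ∸ 1 ≡ suc (2 * (n ∸ 1))
2*n∸1≡1+2*[n∸1] (suc k) _ = +-suc k (k + 0)

cEven-step : ∀ n → 2 ≤ n → (∀ i j → nrm (n ∸ 1) ∣ b (2 * (n ∸ 1)) i j) → ∀ i j →
  (nrm n ∣ b (2 * n) i j) × (cEven n i j ≡ n * cEven (n ∸ 1) i j + (n ∸ 1) * cEven (n ∸ 1) (suc i) j)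
cEven-step n 2≤n nrm∣ i j = linear-quotient {{nrm≢0 (n ∸ 1)}} {{nrm≢0 n}} (2 * n) n (n ∸ 1) (nrm-step n 2≤n) (nrm∣ i j) (nrm∣ (suc i) j)
  (subst (λ N → b (2 * n) i j ≡ 2 * n * n * b N i j + 2 * n * (n ∸ 1) * b N (suc i) j) (sym (*-distribˡ-∸ 2 n 1))
    (b-even-recurrence n 2≤n i j))

cOdd-step : ∀ n → 2 ≤ n → (∀ i j → nrm (n ∸ 1) ∣ b (suc (2 * (n ∸ 1))) i j) → ∀ i j →
  (nrm n ∣ b (suc (2 * n)) i j) × (cOdd n i j ≡ (n + 1) * cOdd (n ∸ 1) i j + n * cOdd (n ∸ 1) (suc i) j)
cOdd-step n 2≤n nrm∣ i j = linear-quotient {{nrm≢0 (n ∸ 1)}} {{nrm≢0 n}} (2 * n) (n + 1) n (nrm-step n 2≤n) (nrm∣ i j) (nrm∣ (suc i) j)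
  (subst₂ (λ A N → b A i j ≡ 2 * n * (n + 1) * b N i j + 2 * n * n * b N (suc i) j) (+-comm (2 * n) 1)
    (2*n∸1≡1+2*[n∸1] n (≤-trans (s≤s z≤n) 2≤n)) (b-odd-recurrence n 2≤n i j))

nrm∣b-even : ∀ n → 1 ≤ n → ∀ i j → nrm n ∣ b (2 * n) i j
nrm∣b-even (suc zero) _ i j = 1∣ _
nrm∣b-even (suc (suc k)) _ = proj₁ ∘₂ cEven-step (suc (suc k)) (s≤s (s≤s z≤n)) (nrm∣b-even (suc k) (s≤s z≤n))

nrm∣b-odd : ∀ n → 1 ≤ n → ∀ i j → nrm n ∣ b (suc (2 * n)) i j
nrm∣b-odd (suc zero) _ i j = 1∣ _
nrm∣b-odd (suc (suc k)) _ = proj₁ ∘₂ cOdd-step (suc (suc k)) (s≤s (s≤s z≤n)) (nrm∣b-odd (suc k) (s≤s z≤n))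

cEven-recurrence : ∀ n → 2 ≤ n → ∀ i j → cEven n i j ≡ n * cEven (n ∸ 1) i j + (n ∸ 1) * cEven (n ∸ 1) (suc i) j
cEven-recurrence (suc zero) (s≤s ())
cEven-recurrence (suc (suc k)) 2≤n = proj₂ ∘₂ cEven-step (suc (suc k)) 2≤n (nrm∣b-even (suc k) (s≤s z≤n))

cOdd-recurrence : ∀ n → 2 ≤ n → ∀ i j → cOdd n i j ≡ (n + 1) * cOdd (n ∸ 1) i j + n * cOdd (n ∸ 1) (suc i) j
cOdd-recurrence (suc zero) (s≤s ())
cOdd-recurrence (suc (suc k)) 2≤n = proj₂ ∘₂ cOdd-step (suc (suc k)) 2≤n (nrm∣b-odd (suc k) (s≤s z≤n))

theorem5p5 : ∀ (n : ℕ) → 2 ≤ n → ∀ (i j : ℕ) →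
    -- (1) set decomposition, as equality of sets together with pairwise disjointness
    ((B n i j ≐ (Shuffle n p12 O (B (n ∸ 2) i j) ∪ Shuffle n p12 E (B (n ∸ 2) (suc i) j) ∪ Shuffle n p21 E (B (n ∸ 2) i (suc j)) ∪ Shuffle n p21 O (B (n ∸ 2) (suc i) (suc j))))
      × (Shuffle n p12 O (B (n ∸ 2) i j) ⊥ Shuffle n p12 E (B (n ∸ 2) (suc i) j))
      × (Shuffle n p12 O (B (n ∸ 2) i j) ⊥ Shuffle n p21 E (B (n ∸ 2) i (suc j)))
      × (Shuffle n p12 O (B (n ∸ 2) i j) ⊥ Shuffle n p21 O (B (n ∸ 2) (suc i) (suc j)))
      × (Shuffle n p12 E (B (n ∸ 2) (suc i) j) ⊥ Shuffle n p21 E (B (n ∸ 2) i (suc j)))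
      × (Shuffle n p12 E (B (n ∸ 2) (suc i) j) ⊥ Shuffle n p21 O (B (n ∸ 2) (suc i) (suc j)))
      × (Shuffle n p21 E (B (n ∸ 2) i (suc j)) ⊥ Shuffle n p21 O (B (n ∸ 2) (suc i) (suc j))))
    -- (2)
    × (b (2 * n) i j ≡ 2 * n * n * b (2 * n ∸ 2) i j + 2 * n * (n ∸ 1) * b (2 * n ∸ 2) (suc i) j)
    × (b (2 * n + 1) i j ≡ 2 * n * (n + 1) * b (2 * n ∸ 1) i j + 2 * n * n * b (2 * n ∸ 1) (suc i) j)
    -- (3) integrality and recurrences
    × (nrm n ∣ b (2 * n) i j)
    × (nrm n ∣ b (2 * n + 1) i j)
    × (cEven n i j ≡ n * cEven (n ∸ 1) i j + (n ∸ 1) * cEven (n ∸ 1) (suc i) j)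
    × (cOdd n i j ≡ (n + 1) * cOdd (n ∸ 1) i j + n * cOdd (n ∸ 1) (suc i) j)
    -- (4)
    × (b n i j ≡ b n (suc i) (suc j))
    -- (5)
    × (b (2 * n) i j ≡ 2 * n * b (2 * n ∸ 1) i j)
theorem5p5 (suc zero) (s≤s ())
theorem5p5 n@(suc (suc m)) 2≤n i j =
  (B≐Components , Components-disjoint) ,
  b-even-recurrence n 2≤n i j ,
  b-odd-recurrence n 2≤n i j ,
  nrm∣b-even n (s≤s z≤n) i j ,
  subst (λ N → nrm n ∣ b N i j) (+-comm 1 (2 * n)) (nrm∣b-odd n (s≤s z≤n) i j) ,
  cEven-recurrence n 2≤n i j ,
  cOdd-recurrence n 2≤n i j ,
  b-suc-suc m i j ,
  b-even≡2n*b-odd n 2≤n i j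
  where open Components m i j
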